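{- Let $\beta \in S_n$ be an $n$-cycle and let $k$ be an integer with $0\le k\le n$. Then \[ c(\leq k, \beta) \leq n\binom{n}{k}(k-1)!-n\binom{n}{k}+n, \] with equality for $0 \leq k \leq 3$ and for $k=n$.
   Context: $S_n$ is the group of permutations of $[n]=\{1,\dots,n\}$; products are composed right to left. The Hamming distance between $\sigma,\tau\in S_n$ is $H(\sigma,\tau)=|\{a\in[n]:\sigma(a)\neq\tau(a)\}|$. For $\beta\in S_n$ and a nonnegative integer $k$, $c(\le k,\beta)$ denotes the number of $\alpha\in S_n$ with $H(\alpha\beta,\beta\alpha)\le k$. An $n$-cycle is a permutation of $[n]$ consisting of a single cycle of length $n$. The convention $(-1)!=1$ is used. -}

module Defs where

open import Data.Nat using (ℕ; zero; suc; _≤_; _≤?_; _!)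
open import Data.Fin using (Fin)
open import Data.Fin.Properties using (all?; any?; _≟_)
open import Data.Vec using (Vec; []; _∷_; lookup; tabulate; count; allFin)
open import Data.List using (List; [_]; concatMap; map; filter; length)
open import Data.Product using (Σ; _×_)
open import Relation.Binary.PropositionalEquality using (_≡_; _≢_)
open import Relation.Nullary using (Dec; ¬?)
open import Relation.Nullary.Decidable using (_→-dec_; _×-dec_)
open import Function using (_∘_)

-- A permutation of [n] (realised as Fin n) is represented by its table of
-- values: the vector whose a-th entry is σ(a).  It must be injective
-- (hence bijective, Fin n being finite).
Tab : ℕ → Set
Tab n = Vec (Fin n) n

app : ∀ {n} → Tab n → Fin n → Fin n
app σ a = lookup σ a

IsPerm : ∀ {n} → Tab n → Set
IsPerm {n} σ = (i j : Fin n) → app σ i ≡ app σ j → i ≡ j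

isPerm? : ∀ {n} (σ : Tab n) → Dec (IsPerm σ)
isPerm? σ = all? λ i → all? λ j → (app σ i ≟ app σ j) →-dec (i ≟ j)

_∘ₚ_ : ∀ {n} → Tab n → Tab n → Tab n
σ ∘ₚ τ = tabulate (λ a → app σ (app τ a))

hamming : ∀ {n} → Tab n → Tab n → ℕ
hamming {n} σ τ = count (λ a → ¬? (app σ a ≟ app τ a)) (allFin n)

allVecs : (n m : ℕ) → List (Vec (Fin n) m)
allVecs n zero    = [ [] ]
allVecs n (suc m) = concatMap (λ x → map (x ∷_) (allVecs n m)) (Data.Vec.toList (allFin n))

allPerms : (n : ℕ) → List (Tab n)
allPerms n = filter isPerm? (allVecs n n)

c≤ : ∀ {n} → ℕ → Tab n → ℕ
c≤ k β = length (filter (λ α → hamming (α ∘ₚ β) (β ∘ₚ α) ≤? k) (allPerms _))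

iter : ∀ {n} → Tab n → ℕ → Fin n → Fin n
iter σ zero    a = a
iter σ (suc m) a = app σ (iter σ m a)

-- σ is an n-cycle: a permutation consisting of a single cycle of length n,
-- i.e. there is a point whose orbit under σ is all of [n].
-- (For n = 0 there is no such point, so there is no 0-cycle.)
IsNCycle : ∀ {n} → Tab n → Set
IsNCycle {n} σ = IsPerm σ × Σ (Fin n) (λ a₀ → (a : Fin n) → Σ ℕ (λ m → iter σ m a₀ ≡ a))

-- (k-1)! with the convention (-1)! = 1
fact-pred : ℕ → ℕ
fact-pred zero    = 1
fact-pred (suc j) = j !

module Submission where

-- Let D(α) be the set of points where αβ and βα disagree, so that
-- H(αβ, βα) = |D(α)|.  Exactly n permutations commute with β (the
-- centralizer of an n-cycle), so c(≤ k, β) = n + #{α : 0 < |D(α)| ≤ k}.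
-- Every such α lies in the class {α : D(α) ⊆ T} of some k-subset T.  A
-- class contains at most n·(k-1)! permutations: walking along the cycle,
-- α is affine on the k blocks cut out by T, hence determined by α(c) and
-- the relative order of the images of the k-1 later blocks.  The union
-- bound over the C(n,k) subsets T gives the inequality.  Equality: for
-- k ≤ 2 the bound on the noncommuting part is 0; for k = n every α counts
-- and the formula gives n!; for k = 3 an explicit block swap and its n
-- translates by powers of β show every class has exactly n noncommuting
-- elements, and each α with H = 3 lies in exactly one class.

open import Defs
open import Data.Nat using (ℕ; zero; suc; _+_; _*_; _∸_; _≤_; _<_; z≤n; s≤s; s≤s⁻¹; _<?_; _≤?_; _≟_; _!; NonZero; >-nonZero; _⊓_; _⊔_)
open import Data.Nat.Properties
open import Data.Nat.DivMod using (_%_; _/_; m≡m%n+[m/n]*n; m%n<n)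
open import Data.Nat.Combinatorics using (_C_; nCn≡1; nCk+nC[k+1]≡[n+1]C[k+1]; k>n⇒nCk≡0)
open import Data.Nat.Combinatorics.Base using (_P′_)
open import Data.Bool using (Bool; true; false; if_then_else_)
import Data.Bool.Properties as BP
open import Data.Fin using (Fin; zero; suc; toℕ; fromℕ<; punchOut)
import Data.Fin.Properties as FP
open import Data.Vec using (Vec; []; _∷_; lookup; tabulate)
import Data.Vec as V
import Data.Vec.Properties as VP
open import Data.List using (List; []; _∷_; [_]; length; filter; map; _++_; concatMap; upTo)
open import Data.Nat.ListAction using (sum)
import Data.List as L
import Data.List.Properties as LP
open import Data.List.Membership.Propositional using (_∈_)
import Data.List.Membership.Propositional.Properties as MP
open import Data.List.Relation.Unary.Any as Any using (here; there)
open import Data.List.Relation.Unary.All as All using (All; []; _∷_)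
open import Data.List.Relation.Unary.AllPairs using ([]; _∷_)
open import Data.List.Relation.Unary.Unique.Propositional using (Unique)
import Data.List.Relation.Unary.Unique.Propositional.Properties as UP
open import Data.Product using (Σ; _×_; _,_; proj₁; proj₂; ∃)
import Data.Product.Properties as PP
open import Data.Sum using (_⊎_; inj₁; inj₂)
open import Data.Empty using (⊥; ⊥-elim)
open import Data.Unit using (⊤; tt)
open import Relation.Nullary using (Dec; yes; no; ¬_; does; ¬?)
open import Relation.Nullary.Decidable using (_×-dec_; _→-dec_)
open import Relation.Unary using (Decidable)
open import Relation.Binary.Definitions using (DecidableEquality; tri<; tri≈; tri>)
open import Relation.Binary.PropositionalEquality hiding ([_])

ind : ∀ {P : Set} → Dec P → ℕ
ind (yes _) = 1
ind (no _) = 0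

count : ∀ {A : Set} {P : A → Set} → Decidable P → List A → ℕ
count P? xs = length (filter P? xs)

ind-yes : ∀ {P : Set} (p : Dec P) → P → ind p ≡ 1
ind-yes (yes _) _ = refl
ind-yes (no ¬p) x = ⊥-elim (¬p x)

ind-no : ∀ {P : Set} (p : Dec P) → ¬ P → ind p ≡ 0
ind-no (yes x) ¬p = ⊥-elim (¬p x)
ind-no (no _) _ = refl

module _ {A : Set} {P : A → Set} (P? : Decidable P) where

  count-∷ : ∀ x xs → count P? (x ∷ xs) ≡ ind (P? x) + count P? xs
  count-∷ x xs with P? x
  ... | yes _ = refl
  ... | no _ = refl

  count-++ : ∀ xs ys → count P? (xs ++ ys) ≡ count P? xs + count P? ys
  count-++ xs ys = trans (cong length (LP.filter-++ P? xs ys)) (LP.length-++ (filter P? xs))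

  count-pos : ∀ {x xs} → x ∈ xs → P x → 1 ≤ count P? xs
  count-pos m px = LP.filter-some P? (Any.map (λ { refl → px }) m)

  count≡0 : ∀ {x xs} → count P? xs ≡ 0 → x ∈ xs → ¬ P x
  count≡0 e m px = <⇒≢ (count-pos m px) (sym e)

  count-none : ∀ xs → (∀ x → x ∈ xs → ¬ P x) → count P? xs ≡ 0
  count-none xs h = cong length (LP.filter-none P? {xs} (All.tabulate (λ m → h _ m)))

  count-all : ∀ xs → (∀ x → P x) → count P? xs ≡ length xs
  count-all xs h = cong length (LP.filter-all P? {xs} (All.tabulate (λ {x} _ → h x)))

count-compl : ∀ {A : Set} {P : A → Set} (P? : Decidable P) xs → count P? xs + count (λ x → ¬? (P? x)) xs ≡ length xs
count-compl P? [] = refl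
count-compl P? (x ∷ xs) rewrite count-∷ P? x xs | count-∷ (λ x → ¬? (P? x)) x xs with P? x
... | yes p = cong suc (count-compl P? xs)
... | no _ = trans (+-suc _ _) (cong suc (count-compl P? xs))

count-map : ∀ {A B : Set} {P : B → Set} (P? : Decidable P) (g : A → B) ys → count P? (map g ys) ≡ count (λ y → P? (g y)) ys
count-map P? g [] = refl
count-map P? g (y ∷ ys) rewrite count-∷ P? (g y) (map g ys) | count-∷ (λ y → P? (g y)) y ys | count-map P? g ys = refl

count-mono : ∀ {A : Set} {P Q : A → Set} (P? : Decidable P) (Q? : Decidable Q) xs →
  (∀ x → x ∈ xs → P x → Q x) → count P? xs ≤ count Q? xs
count-mono P? Q? [] f = z≤n
count-mono P? Q? (x ∷ xs) f rewrite count-∷ P? x xs | count-∷ Q? x xs with P? x | Q? x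
... | yes _ | yes _ = s≤s (count-mono P? Q? xs (λ y m → f y (there m)))
... | yes p | no ¬q = ⊥-elim (¬q (f x (here refl) p))
... | no _ | yes _ = m≤n⇒m≤1+n (count-mono P? Q? xs (λ y m → f y (there m)))
... | no _ | no _ = count-mono P? Q? xs (λ y m → f y (there m))

count-cong : ∀ {A : Set} {P Q : A → Set} (P? : Decidable P) (Q? : Decidable Q) xs →
  (∀ x → x ∈ xs → P x → Q x) → (∀ x → x ∈ xs → Q x → P x) → count P? xs ≡ count Q? xs
count-cong P? Q? xs f g = ≤-antisym (count-mono P? Q? xs f) (count-mono Q? P? xs g)

count-mono< : ∀ {A : Set} {P Q : A → Set} (P? : Decidable P) (Q? : Decidable Q) xs →
  (∀ x → x ∈ xs → P x → Q x) → ∀ {y} → y ∈ xs → Q y → ¬ P y → count P? xs < count Q? xs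
count-mono< P? Q? (x ∷ xs) f (here refl) qy ¬py rewrite count-∷ P? x xs | count-∷ Q? x xs with P? x | Q? x
... | yes p | _ = ⊥-elim (¬py p)
... | no _ | yes _ = s≤s (count-mono P? Q? xs (λ y m → f y (there m)))
... | no _ | no ¬q = ⊥-elim (¬q qy)
count-mono< P? Q? (x ∷ xs) f (there m) qy ¬py rewrite count-∷ P? x xs | count-∷ Q? x xs with P? x | Q? x
... | yes _ | yes _ = s≤s (count-mono< P? Q? xs (λ y m → f y (there m)) m qy ¬py)
... | yes p | no ¬q = ⊥-elim (¬q (f x (here refl) p))
... | no _ | yes _ = m≤n⇒m≤1+n (count-mono< P? Q? xs (λ y m → f y (there m)) m qy ¬py)
... | no _ | no _ = count-mono< P? Q? xs (λ y m → f y (there m)) m qy ¬py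

count-split : ∀ {A : Set} {P Q : A → Set} (P? : Decidable P) (Q? : Decidable Q) xs →
  count P? xs ≡ count (λ x → P? x ×-dec Q? x) xs + count (λ x → P? x ×-dec ¬? (Q? x)) xs
count-split P? Q? [] = refl
count-split P? Q? (x ∷ xs) rewrite count-∷ P? x xs | count-∷ (λ x → P? x ×-dec Q? x) x xs
  | count-∷ (λ x → P? x ×-dec ¬? (Q? x)) x xs | count-split P? Q? xs with P? x | Q? x
... | yes _ | yes _ = refl
... | yes _ | no _ = sym (+-suc _ _)
... | no _ | yes _ = refl
... | no _ | no _ = refl

module _ {A : Set} (_≟_ : DecidableEquality A) where
  private
    delete : A → List A → List A
    delete x [] = []
    delete x (y ∷ ys) with x ≟ y
    ... | yes _ = ys
    ... | no _ = y ∷ delete x ys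

    length-delete : ∀ {x ys} → x ∈ ys → suc (length (delete x ys)) ≡ length ys
    length-delete {x} {y ∷ ys} m with x ≟ y | m
    ... | yes _ | _ = refl
    ... | no x≢y | here refl = ⊥-elim (x≢y refl)
    ... | no _ | there m' = cong suc (length-delete m')

    ∈-delete : ∀ {x z ys} → z ∈ ys → z ≢ x → z ∈ delete x ys
    ∈-delete {x} {z} {y ∷ ys} m z≢x with x ≟ y | m
    ... | yes refl | here refl = ⊥-elim (z≢x refl)
    ... | yes refl | there m' = m'
    ... | no _ | here refl = here refl
    ... | no _ | there m' = there (∈-delete m' z≢x)

  unique-length-≤ : ∀ {xs ys} → Unique xs → (∀ {z} → z ∈ xs → z ∈ ys) → length xs ≤ length ys
  unique-length-≤ {[]} _ _ = z≤n
  unique-length-≤ {x ∷ xs} {ys} (x∉ ∷ u) sub =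
    subst (suc (length xs) ≤_) (length-delete (sub (here refl)))
      (s≤s (unique-length-≤ u (λ m → ∈-delete (sub (there m)) (λ eq → All.lookup x∉ m (sym eq)))))

unique-map : ∀ {A B : Set} (f : A → B) {xs : List A} → Unique xs →
  (∀ {x y} → x ∈ xs → y ∈ xs → f x ≡ f y → x ≡ y) → Unique (map f xs)
unique-map f {[]} _ _ = []
unique-map f {x ∷ xs} (a ∷ u) inj = fresh xs (λ m → there m) a ∷ unique-map f u (λ mx my → inj (there mx) (there my))
  where
  fresh : ∀ ys → (∀ {y} → y ∈ ys → y ∈ (x ∷ xs)) → All (x ≢_) ys → All (f x ≢_) (map f ys)
  fresh [] _ _ = []
  fresh (y ∷ ys) sub (b ∷ blockStart) = (λ e → b (inj (here refl) (sub (here refl)) e)) ∷ fresh ys (λ m → sub (there m)) blockStart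

count-≤-by-injection : ∀ {A B : Set} (_≟_ : DecidableEquality B) {P : A → Set} (P? : Decidable P)
  (xs : List A) (ys : List B) (f : A → B) → Unique xs →
  (∀ {x y} → x ∈ xs → y ∈ xs → P x → P y → f x ≡ f y → x ≡ y) →
  (∀ {x} → x ∈ xs → P x → f x ∈ ys) → count P? xs ≤ length ys
count-≤-by-injection _≟_ P? xs ys f u inj into =
  subst (_≤ length ys) (LP.length-map f (filter P? xs))
    (unique-length-≤ _≟_ (unique-map f (UP.filter⁺ P? u)
       (λ mx my → let (a , b) = MP.∈-filter⁻ P? mx ; (c , d) = MP.∈-filter⁻ P? my in inj a c b d))
       λ m → let (x , mx , eq) = MP.∈-map⁻ f m
                 (a , b) = MP.∈-filter⁻ P? mx in subst (_∈ ys) (sym eq) (into a b))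

sum-map-+ : ∀ {T : Set} (g h : T → ℕ) ts → sum (map (λ t → g t + h t) ts) ≡ sum (map g ts) + sum (map h ts)
sum-map-+ g h [] = refl
sum-map-+ g h (t ∷ ts) rewrite sum-map-+ g h ts = +-exchange (g t) (h t) _ _
  where
  +-exchange : ∀ a b c d → a + b + (c + d) ≡ a + c + (b + d)
  +-exchange a b c d = begin
    a + b + (c + d)   ≡⟨ +-assoc a b (c + d) ⟩
    a + (b + (c + d)) ≡⟨ cong (a +_) (+-comm b (c + d)) ⟩
    a + ((c + d) + b) ≡⟨ cong (a +_) (+-assoc c d b) ⟩
    a + (c + (d + b)) ≡⟨ cong (λ z → a + (c + z)) (+-comm d b) ⟩
    a + (c + (b + d)) ≡⟨ sym (+-assoc a c (b + d)) ⟩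
    a + c + (b + d)   ∎
    where open ≡-Reasoning

sum-map-* : ∀ {T : Set} (g : T → ℕ) c ts → sum (map (λ t → g t * c) ts) ≡ sum (map g ts) * c
sum-map-* g c [] = refl
sum-map-* g c (t ∷ ts) rewrite sum-map-* g c ts = sym (*-distribʳ-+ c (g t) _)

sum-map-cong : ∀ {T : Set} (g h : T → ℕ) ts → (∀ t → t ∈ ts → g t ≡ h t) → sum (map g ts) ≡ sum (map h ts)
sum-map-cong g h [] _ = refl
sum-map-cong g h (t ∷ ts) e = cong₂ _+_ (e t (here refl)) (sum-map-cong g h ts (λ t m → e t (there m)))

sum-map-mono : ∀ {T : Set} (g h : T → ℕ) ts → (∀ t → t ∈ ts → g t ≤ h t) → sum (map g ts) ≤ sum (map h ts)
sum-map-mono g h [] _ = z≤n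
sum-map-mono g h (t ∷ ts) e = +-mono-≤ (e t (here refl)) (sum-map-mono g h ts (λ t m → e t (there m)))

sum-map-const : ∀ {T : Set} (c : ℕ) (ts : List T) → sum (map (λ _ → c) ts) ≡ length ts * c
sum-map-const c [] = refl
sum-map-const c (x ∷ ts) = cong (c +_) (sum-map-const c ts)

sum-map-≤ : ∀ {T : Set} (g : T → ℕ) M ts → (∀ t → t ∈ ts → g t ≤ M) → sum (map g ts) ≤ length ts * M
sum-map-≤ g M ts b = subst (sum (map g ts) ≤_) (sum-map-const M ts) (sum-map-mono g (λ _ → M) ts b)

sum-ind : ∀ {T : Set} {Q : T → Set} (Q? : Decidable Q) ts → sum (map (λ t → ind (Q? t)) ts) ≡ count Q? ts
sum-ind Q? [] = refl
sum-ind Q? (t ∷ ts) rewrite count-∷ Q? t ts | sum-ind Q? ts = refl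

count-concatMap : ∀ {A B : Set} {P : B → Set} (P? : Decidable P) (f : A → List B) xs →
  count P? (concatMap f xs) ≡ sum (map (λ x → count P? (f x)) xs)
count-concatMap P? f [] = refl
count-concatMap P? f (x ∷ xs) = trans (count-++ P? (f x) (concatMap f xs)) (cong (count P? (f x) +_) (count-concatMap P? f xs))

double-count : ∀ {A B : Set} {R : A → B → Set} (R? : ∀ x y → Dec (R x y)) xs ys →
  sum (map (λ x → count (R? x) ys) xs) ≡ sum (map (λ y → count (λ x → R? x y) xs) ys)
double-count R? [] ys = sym (trans (sum-map-const 0 ys) (*-zeroʳ (length ys)))
double-count R? (x ∷ xs) ys = sym (begin
    sum (map (λ y → count (λ x' → R? x' y) (x ∷ xs)) ys)
      ≡⟨ sum-map-cong _ (λ y → ind (R? x y) + count (λ x' → R? x' y) xs) ys (λ y _ → count-∷ (λ x' → R? x' y) x xs) ⟩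
    sum (map (λ y → ind (R? x y) + count (λ x' → R? x' y) xs) ys)
      ≡⟨ sum-map-+ (λ y → ind (R? x y)) _ ys ⟩
    sum (map (λ y → ind (R? x y)) ys) + sum (map (λ y → count (λ x' → R? x' y) xs) ys)
      ≡⟨ cong₂ _+_ (sum-ind (R? x) ys) (sym (double-count R? xs ys)) ⟩
    count (R? x) ys + sum (map (λ x → count (R? x) ys) xs) ∎)
  where open ≡-Reasoning

module _ {A T : Set} {P : A → Set} {Q : T → A → Set} (P? : Decidable P) (Q? : ∀ t → Decidable (Q t)) where

  union-bound : ∀ xs ts → (∀ x → x ∈ xs → P x → ∃ λ t → t ∈ ts × Q t x) →
    count P? xs ≤ sum (map (λ t → count (Q? t) xs) ts)
  union-bound xs ts h = begin
    count P? xs                                       ≡⟨ sym (sum-ind P? xs) ⟩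
    sum (map (λ x → ind (P? x)) xs)                   ≤⟨ sum-map-mono _ _ xs covered ⟩
    sum (map (λ x → count (λ t → Q? t x) ts) xs)      ≡⟨ double-count (λ x t → Q? t x) xs ts ⟩
    sum (map (λ t → count (Q? t) xs) ts)              ∎
    where
    open ≤-Reasoning
    covered : ∀ x → x ∈ xs → ind (P? x) ≤ count (λ t → Q? t x) ts
    covered x m with P? x
    ... | no _ = z≤n
    ... | yes px = let (t , mt , q) = h x m px in count-pos (λ t → Q? t x) mt q

  exact-cover : ∀ xs ts → (∀ x → x ∈ xs → count (λ t → Q? t x) ts ≡ ind (P? x)) →
    count P? xs ≡ sum (map (λ t → count (Q? t) xs) ts)
  exact-cover xs ts h = begin
    count P? xs                                       ≡⟨ sym (sum-ind P? xs) ⟩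
    sum (map (λ x → ind (P? x)) xs)                   ≡⟨ sum-map-cong _ _ xs (λ x m → sym (h x m)) ⟩
    sum (map (λ x → count (λ t → Q? t x) ts) xs)      ≡⟨ double-count (λ x t → Q? t x) xs ts ⟩
    sum (map (λ t → count (Q? t) xs) ts)              ∎
    where open ≡-Reasoning

vec-ext : ∀ {A : Set} {n} {u v : Vec A n} → (∀ i → lookup u i ≡ lookup v i) → u ≡ v
vec-ext {u = u} {v} h = trans (sym (VP.tabulate∘lookup u)) (trans (VP.tabulate-cong h) (VP.tabulate∘lookup v))

finList : (n : ℕ) → List (Fin n)
finList n = V.toList (V.allFin n)

toList-tabulate : ∀ {A : Set} n (f : Fin n → A) → V.toList (V.tabulate f) ≡ L.tabulate f
toList-tabulate zero f = refl
toList-tabulate (suc n) f = cong (f zero ∷_) (toList-tabulate n (λ i → f (suc i)))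

∈-finList : ∀ {n} (x : Fin n) → x ∈ finList n
∈-finList {n} x rewrite toList-tabulate n (λ i → i) = MP.∈-allFin x

unique-finList : ∀ n → Unique (finList n)
unique-finList n rewrite toList-tabulate n (λ i → i) = UP.allFin⁺ n

length-finList : ∀ n → length (finList n) ≡ n
length-finList n rewrite toList-tabulate n (λ i → i) = LP.length-tabulate (λ i → i)

finList-suc : ∀ n → finList (suc n) ≡ zero ∷ map suc (finList n)
finList-suc n = cong (zero ∷_) (trans (toList-tabulate n suc)
  (trans (sym (LP.map-tabulate (λ i → i) suc)) (cong (map suc) (sym (toList-tabulate n (λ i → i))))))

vec≟ : ∀ {n m} → DecidableEquality (Vec (Fin n) m)
vec≟ = VP.≡-dec FP._≟_

∈-allVecs : ∀ n m (v : Vec (Fin n) m) → v ∈ allVecs n m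
∈-allVecs n zero [] = here refl
∈-allVecs n (suc m) (x ∷ v) = MP.∈-concatMap⁺ (λ x → map (x ∷_) (allVecs n m))
  (Any.map (λ { refl → MP.∈-map⁺ (x ∷_) (∈-allVecs n m v) }) (∈-finList x))

unique-concatMap : ∀ {A B : Set} (f : A → List B) (xs : List A) → Unique xs → (∀ x → Unique (f x)) →
  (∀ {x y z} → z ∈ f x → z ∈ f y → x ≡ y) → Unique (concatMap f xs)
unique-concatMap f [] _ _ _ = []
unique-concatMap f (x ∷ xs) (a ∷ u) uf d = UP.++⁺ (uf x) (unique-concatMap f xs u uf d) disjoint
  where
  disjoint : ∀ {z} → z ∈ f x × z ∈ concatMap f xs → ⊥
  disjoint (m1 , m2) = let (l , mz , ml) = MP.∈-concat⁻′ (map f xs) m2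
                           (y' , my' , e) = MP.∈-map⁻ f ml
                       in All.lookup a my' (d m1 (subst (_ ∈_) e mz))

unique-allVecs : ∀ n m → Unique (allVecs n m)
unique-allVecs n zero = [] ∷ []
unique-allVecs n (suc m) = unique-concatMap _ (finList n) (unique-finList n)
  (λ x → unique-map (x ∷_) (unique-allVecs n m) (λ _ _ e → VP.∷-injectiveʳ e))
  λ m1 m2 → let (v , _ , v≡) = MP.∈-map⁻ _ m1 ; (w , _ , w≡) = MP.∈-map⁻ _ m2 in VP.∷-injectiveˡ (trans (sym v≡) w≡)

-- Prepending x to an injective v keeps
-- it injective iff x does not occur in v; an injective v of length m has
-- exactly m occurring values, hence N ∸ m admissible new heads.
InjectiveVec : ∀ {N m} → Vec (Fin N) m → Set
InjectiveVec {N} {m} v = (i j : Fin m) → lookup v i ≡ lookup v j → i ≡ j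

injectiveVec? : ∀ {N m} (v : Vec (Fin N) m) → Dec (InjectiveVec v)
injectiveVec? v = FP.all? λ i → FP.all? λ j → (lookup v i FP.≟ lookup v j) →-dec (i FP.≟ j)

Occurs : ∀ {N m} → Fin N → Vec (Fin N) m → Set
Occurs x v = ∃ λ i → lookup v i ≡ x

occurs? : ∀ {N m} (x : Fin N) (v : Vec (Fin N) m) → Dec (Occurs x v)
occurs? x v = FP.any? λ i → lookup v i FP.≟ x

injective-∷⁻ : ∀ {N m} {x : Fin N} {v : Vec (Fin N) m} → InjectiveVec (x ∷ v) → InjectiveVec v × ¬ Occurs x v
injective-∷⁻ h = (λ i j e → FP.suc-injective (h (suc i) (suc j) e)) , λ { (i , e) → FP.0≢1+n (sym (h (suc i) zero e)) }

injective-∷⁺ : ∀ {N m} {x : Fin N} {v : Vec (Fin N) m} → InjectiveVec v → ¬ Occurs x v → InjectiveVec (x ∷ v)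
injective-∷⁺ h n zero zero e = refl
injective-∷⁺ h n zero (suc j) e = ⊥-elim (n (j , sym e))
injective-∷⁺ h n (suc i) zero e = ⊥-elim (n (i , e))
injective-∷⁺ h n (suc i) (suc j) e = cong suc (h i j e)

count-occurs : ∀ {N m} (v : Vec (Fin N) m) → InjectiveVec v → count (λ x → occurs? x v) (finList N) ≡ m
count-occurs {N} {m} v h = ≤-antisym
  (subst (count (λ x → occurs? x v) (finList N) ≤_) (trans (LP.length-map (lookup v) (finList m)) (length-finList m))
     (count-≤-by-injection FP._≟_ (λ x → occurs? x v) (finList N) (map (lookup v) (finList m)) (λ x → x) (unique-finList N)
       (λ _ _ _ _ e → e) (λ { _ (i , refl) → MP.∈-map⁺ (lookup v) (∈-finList i) })))
  (subst (_≤ count (λ x → occurs? x v) (finList N)) (trans (count-all (λ _ → yes tt) (finList m) (λ _ → tt)) (length-finList m))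
     (count-≤-by-injection FP._≟_ (λ _ → yes tt) (finList m) (filter (λ x → occurs? x v) (finList N)) (lookup v) (unique-finList m)
       (λ _ _ _ _ e → h _ _ e)
       λ {i} _ _ → MP.∈-filter⁺ (λ x → occurs? x v) (∈-finList (lookup v i)) (i , refl)))

count-fresh-heads : ∀ {N m} (v : Vec (Fin N) m) →
  count (λ x → injectiveVec? (x ∷ v)) (finList N) ≡ ind (injectiveVec? v) * (N ∸ m)
count-fresh-heads {N} {m} v with injectiveVec? v
... | no ¬h = count-none (λ x → injectiveVec? (x ∷ v)) (finList N) (λ x _ h → ¬h (proj₁ (injective-∷⁻ h)))
... | yes h = begin
   count (λ x → injectiveVec? (x ∷ v)) (finList N)
     ≡⟨ count-cong (λ x → injectiveVec? (x ∷ v)) (λ x → ¬? (occurs? x v)) (finList N)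
          (λ x _ p → proj₂ (injective-∷⁻ p)) (λ x _ p → injective-∷⁺ h p) ⟩
   count (λ x → ¬? (occurs? x v)) (finList N)
     ≡⟨ sym (m+n∸m≡n m _) ⟩
   m + count (λ x → ¬? (occurs? x v)) (finList N) ∸ m
     ≡⟨ cong (λ z → z + count (λ x → ¬? (occurs? x v)) (finList N) ∸ m) (sym (count-occurs v h)) ⟩
   count (λ x → occurs? x v) (finList N) + count (λ x → ¬? (occurs? x v)) (finList N) ∸ m
     ≡⟨ cong (_∸ m) (trans (count-compl (λ x → occurs? x v) (finList N)) (length-finList N)) ⟩
   N ∸ m
     ≡⟨ sym (+-identityʳ _) ⟩
   1 * (N ∸ m) ∎
  where open ≡-Reasoning

-- There are N P′ m = N (N-1) ⋯ (N-m+1) injective vectors of length m: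
-- split on the head and double count.
count-injectiveVecs : ∀ N m → count injectiveVec? (allVecs N m) ≡ N P′ m
count-injectiveVecs N zero = refl
count-injectiveVecs N (suc m) = begin
  count injectiveVec? (allVecs N (suc m))
    ≡⟨ count-concatMap injectiveVec? (λ x → map (x ∷_) (allVecs N m)) (finList N) ⟩
  sum (map (λ x → count injectiveVec? (map (x ∷_) (allVecs N m))) (finList N))
    ≡⟨ sum-map-cong _ _ (finList N) (λ x _ → count-map injectiveVec? (x ∷_) (allVecs N m)) ⟩
  sum (map (λ x → count (λ v → injectiveVec? (x ∷ v)) (allVecs N m)) (finList N))
    ≡⟨ double-count (λ x v → injectiveVec? (x ∷ v)) (finList N) (allVecs N m) ⟩
  sum (map (λ v → count (λ x → injectiveVec? (x ∷ v)) (finList N)) (allVecs N m))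
    ≡⟨ sum-map-cong _ _ (allVecs N m) (λ v _ → count-fresh-heads v) ⟩
  sum (map (λ v → ind (injectiveVec? v) * (N ∸ m)) (allVecs N m))
    ≡⟨ sum-map-* (λ v → ind (injectiveVec? v)) (N ∸ m) (allVecs N m) ⟩
  sum (map (λ v → ind (injectiveVec? v)) (allVecs N m)) * (N ∸ m)
    ≡⟨ cong (_* (N ∸ m)) (trans (sum-ind injectiveVec? (allVecs N m)) (count-injectiveVecs N m)) ⟩
  (N P′ m) * (N ∸ m)
    ≡⟨ *-comm (N P′ m) (N ∸ m) ⟩
  N P′ (suc m) ∎
  where open ≡-Reasoning

P′-fact : ∀ N m → m ≤ N → (N P′ m) * (N ∸ m) ! ≡ N !
P′-fact N zero _ = +-identityʳ _
P′-fact N (suc m) sm≤N = begin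
  (N ∸ m) * (N P′ m) * (N ∸ suc m) !
    ≡⟨ cong (λ z → z * (N P′ m) * (N ∸ suc m) !) N∸m≡1+N∸[1+m] ⟩
  suc (N ∸ suc m) * (N P′ m) * (N ∸ suc m) !
    ≡⟨ x∙y∙z≡y∙[x∙z] (suc (N ∸ suc m)) (N P′ m) ((N ∸ suc m) !) ⟩
  (N P′ m) * (suc (N ∸ suc m) * (N ∸ suc m) !)
    ≡⟨ cong (λ z → (N P′ m) * z !) (sym N∸m≡1+N∸[1+m]) ⟩
  (N P′ m) * (N ∸ m) !
    ≡⟨ P′-fact N m (≤-trans (n≤1+n m) sm≤N) ⟩
  N ! ∎
  where
  open ≡-Reasoning
  N∸m≡1+N∸[1+m] : N ∸ m ≡ suc (N ∸ suc m)
  N∸m≡1+N∸[1+m] = +-∸-assoc 1 sm≤N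
  x∙y∙z≡y∙[x∙z] : ∀ a b c → a * b * c ≡ b * (a * c)
  x∙y∙z≡y∙[x∙z] a b c = trans (cong (_* c) (*-comm a b)) (*-assoc b a c)

length-allPerms : ∀ m → length (allPerms m) ≡ m !
length-allPerms m = begin
  length (allPerms m)   ≡⟨ count-injectiveVecs m m ⟩
  m P′ m                ≡⟨ sym (*-identityʳ _) ⟩
  (m P′ m) * 1          ≡⟨ cong (λ z → (m P′ m) * z !) (sym (n∸n≡0 m)) ⟩
  (m P′ m) * (m ∸ m) !  ≡⟨ P′-fact m m ≤-refl ⟩
  m !                   ∎
  where open ≡-Reasoning

module Powers {n : ℕ} (σ : Tab n) where

  iter-+ : ∀ m m' x → iter σ (m + m') x ≡ iter σ m (iter σ m' x)
  iter-+ zero m' x = refl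
  iter-+ (suc m) m' x = cong (app σ) (iter-+ m m' x)

  iter-comm : ∀ m m' x → iter σ m (iter σ m' x) ≡ iter σ m' (iter σ m x)
  iter-comm m m' x = trans (sym (iter-+ m m' x)) (trans (cong (λ z → iter σ z x) (+-comm m m')) (iter-+ m' m x))

  iter-mul : ∀ d {x} → iter σ d x ≡ x → ∀ q → iter σ (q * d) x ≡ x
  iter-mul d e zero = refl
  iter-mul d {x} e (suc q) = trans (iter-+ d (q * d) x) (trans (cong (iter σ d) (iter-mul d e q)) e)

  iter-inj : IsPerm σ → ∀ m {x y} → iter σ m x ≡ iter σ m y → x ≡ y
  iter-inj σ-inj zero e = e
  iter-inj σ-inj (suc m) e = iter-inj σ-inj m (σ-inj _ _ e)

module NCycle {n' : ℕ} (β : Tab (suc n')) (hβ : IsNCycle β) where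
  open Powers β public

  n : ℕ
  n = suc n'

  a₀ : Fin n
  a₀ = proj₁ (proj₂ hβ)

  orb : (a : Fin n) → Σ ℕ (λ m → iter β m a₀ ≡ a)
  orb = proj₂ (proj₂ hβ)

  β-iter-inj : ∀ m {x y} → iter β m x ≡ iter β m y → x ≡ y
  β-iter-inj = iter-inj (proj₁ hβ)

  -- Any positive period d of a₀ is at least n: reducing exponents mod d
  -- maps Fin n injectively into Fin d.
  period-bound : ∀ d → .{{_ : NonZero d}} → iter β d a₀ ≡ a₀ → n ≤ d
  period-bound d e = FP.injective⇒≤ {f = h} h-inj
    where
    reduce : ∀ m → iter β m a₀ ≡ iter β (m % d) a₀
    reduce m = trans (cong (λ z → iter β z a₀) (m≡m%n+[m/n]*n m d))
                     (trans (iter-+ (m % d) _ a₀) (cong (iter β (m % d)) (iter-mul d e (m / d))))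
    h : Fin n → Fin d
    h a = fromℕ< (m%n<n (proj₁ (orb a)) d)
    h-inj : ∀ {a b} → h a ≡ h b → a ≡ b
    h-inj {a} {b} e' = trans (sym (proj₂ (orb a))) (trans (reduce _) (trans
       (cong (λ z → iter β z a₀) (trans (sym (FP.toℕ-fromℕ< _)) (trans (cong toℕ e') (FP.toℕ-fromℕ< _))))
       (trans (sym (reduce _)) (proj₂ (orb b)))))

  -- By pigeonhole on a₀, βa₀, …, β^n a₀, some period d satisfies 1 ≤ d ≤ n.
  period-exists : Σ ℕ (λ d → (0 < d) × (d ≤ n) × iter β d a₀ ≡ a₀)
  period-exists with FP.pigeonhole (n<1+n n) (λ (i : Fin (suc n)) → iter β (toℕ i) a₀)
  ... | i , j , i<j , e = d , 0<d , d≤n , β-iter-inj (toℕ i) e'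
    where
    d = toℕ j ∸ toℕ i
    0<d : 0 < d
    0<d = m<n⇒0<n∸m i<j
    d≤n : d ≤ n
    d≤n = ≤-trans (m∸n≤m (toℕ j) (toℕ i)) (s≤s⁻¹ (FP.toℕ<n j))
    e' : iter β (toℕ i) (iter β d a₀) ≡ iter β (toℕ i) a₀
    e' = trans (iter-comm (toℕ i) d a₀) (trans (sym (iter-+ d (toℕ i) a₀))
           (trans (cong (λ z → iter β z a₀) (m∸n+n≡m (<⇒≤ i<j))) (sym e)))

  iter-n : ∀ x → iter β n x ≡ x
  iter-n x = trans (cong (iter β n) (sym (proj₂ (orb x))))
              (trans (iter-comm n i a₀) (trans (cong (iter β i) period-n) (proj₂ (orb x))))
    where
    i = proj₁ (orb x)
    period-n : iter β n a₀ ≡ a₀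
    period-n with period-exists
    ... | suc d' , _ , d≤n , e with ≤-antisym d≤n (period-bound (suc d') e)
    ... | refl = e

  iter-mod : ∀ m x → iter β m x ≡ iter β (m % n) x
  iter-mod m x = trans (cong (λ z → iter β z x) (m≡m%n+[m/n]*n m n))
                  (trans (iter-+ (m % n) _ x) (cong (iter β (m % n)) (iter-mul n (iter-n x) (m / n))))

  -- β^m x for m < n are pairwise distinct: a coincidence would give a
  -- period of x, hence of a₀, smaller than n.
  iter-distinct : ∀ {m m' x} → m < m' → m' < n → iter β m x ≢ iter β m' x
  iter-distinct {m} {m'} {x} m<m' m'<n e = <⇒≱ (≤-<-trans (m∸n≤m m' m) m'<n) (period-bound d {{d≢0}} period-a₀)
    where
    d = m' ∸ m
    d≢0 : NonZero d
    d≢0 = >-nonZero (m<n⇒0<n∸m m<m')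
    period-x : iter β d x ≡ x
    period-x = β-iter-inj m (trans (iter-comm m d x) (trans (sym (iter-+ d m x))
                 (trans (cong (λ z → iter β z x) (m∸n+n≡m (<⇒≤ m<m'))) (sym e))))
    i = proj₁ (orb x)
    period-a₀ : iter β d a₀ ≡ a₀
    period-a₀ = β-iter-inj i (trans (iter-comm i d a₀) (trans (cong (iter β d) (proj₂ (orb x)))
                  (trans period-x (sym (proj₂ (orb x))))))

  iter-uniq : ∀ {m m' x} → m < n → m' < n → iter β m x ≡ iter β m' x → m ≡ m'
  iter-uniq {m} {m'} m<n m'<n e with <-cmp m m'
  ... | tri< a _ _ = ⊥-elim (iter-distinct a m'<n e)
  ... | tri≈ _ b _ = b
  ... | tri> _ _ c = ⊥-elim (iter-distinct c m<n (sym e))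

  -- Every y is reached from every x: go back to a₀ (i·(n-1) steps undo
  -- i steps, as β^n = id) and then forward to y.
  reach : ∀ x y → Σ ℕ (λ m → iter β m x ≡ y)
  reach x y = j + i * n' , e
    where
    i = proj₁ (orb x)
    j = proj₁ (orb y)
    e : iter β (j + i * n') x ≡ y
    e = begin
      iter β (j + i * n') x              ≡⟨ cong (iter β (j + i * n')) (sym (proj₂ (orb x))) ⟩
      iter β (j + i * n') (iter β i a₀)  ≡⟨ sym (iter-+ (j + i * n') i a₀) ⟩
      iter β (j + i * n' + i) a₀         ≡⟨ cong (λ z → iter β z a₀) j+in'+i≡j+in ⟩
      iter β (j + i * n) a₀              ≡⟨ iter-+ j (i * n) a₀ ⟩
      iter β j (iter β (i * n) a₀)       ≡⟨ cong (iter β j) (iter-mul n (iter-n a₀) i) ⟩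
      iter β j a₀                        ≡⟨ proj₂ (orb y) ⟩
      y                                  ∎
      where
      open ≡-Reasoning
      j+in'+i≡j+in : j + i * n' + i ≡ j + i * n
      j+in'+i≡j+in = trans (+-assoc j (i * n') i) (cong (j +_) (trans (+-comm (i * n') i) (sym (*-suc i n'))))

  steps : Fin n → Fin n → ℕ
  steps x y = proj₁ (reach x y) % n

  steps-< : ∀ x y → steps x y < n
  steps-< x y = m%n<n (proj₁ (reach x y)) n

  iter-steps : ∀ x y → iter β (steps x y) x ≡ y
  iter-steps x y = trans (sym (iter-mod (proj₁ (reach x y)) x)) (proj₂ (reach x y))

  steps-unique : ∀ {m x y} → m < n → iter β m x ≡ y → m ≡ steps x y
  steps-unique {m} {x} {y} m<n e = iter-uniq m<n (steps-< x y) (trans e (sym (iter-steps x y)))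

  steps-self : ∀ x → steps x x ≡ 0
  steps-self x = sym (steps-unique {0} (s≤s z≤n) refl)

-- Subsets of Fin n are Boolean vectors (membership = true); size counts
-- the members and s ⊆ t is inclusion, decided entrywise.
size : ∀ {n} → Vec Bool n → ℕ
size [] = 0
size (true ∷ v) = suc (size v)
size (false ∷ v) = size v

true≢false : true ≢ false
true≢false ()

infix 4 _⊆_ _⊆?_

_⊆_ : ∀ {n} → Vec Bool n → Vec Bool n → Set
[] ⊆ [] = ⊤
(false ∷ s) ⊆ (_ ∷ t) = s ⊆ t
(true ∷ s) ⊆ (true ∷ t) = s ⊆ t
(true ∷ s) ⊆ (false ∷ t) = ⊥

_⊆?_ : ∀ {n} (s t : Vec Bool n) → Dec (s ⊆ t)
[] ⊆? [] = yes tt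
(false ∷ s) ⊆? (_ ∷ t) = s ⊆? t
(true ∷ s) ⊆? (true ∷ t) = s ⊆? t
(true ∷ s) ⊆? (false ∷ t) = no (λ ())

⊆-lookup : ∀ {n} {s t : Vec Bool n} → s ⊆ t → ∀ i → lookup s i ≡ true → lookup t i ≡ true
⊆-lookup {s = true ∷ s} {true ∷ t} h zero e = refl
⊆-lookup {s = false ∷ s} {_ ∷ t} h zero ()
⊆-lookup {s = false ∷ s} {_ ∷ t} h (suc i) e = ⊆-lookup {s = s} h i e
⊆-lookup {s = true ∷ s} {true ∷ t} h (suc i) e = ⊆-lookup {s = s} h i e

⊆-from-lookup : ∀ {n} (s t : Vec Bool n) → (∀ i → lookup s i ≡ true → lookup t i ≡ true) → s ⊆ t
⊆-from-lookup [] [] h = tt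
⊆-from-lookup (false ∷ s) (_ ∷ t) h = ⊆-from-lookup s t (λ i → h (suc i))
⊆-from-lookup (true ∷ s) (true ∷ t) h = ⊆-from-lookup s t (λ i → h (suc i))
⊆-from-lookup (true ∷ s) (false ∷ t) h with h zero refl
... | ()

⊆-size : ∀ {n} {s t : Vec Bool n} → s ⊆ t → size s ≤ size t
⊆-size {s = []} {[]} h = z≤n
⊆-size {s = false ∷ s} {false ∷ t} h = ⊆-size {s = s} h
⊆-size {s = false ∷ s} {true ∷ t} h = m≤n⇒m≤1+n (⊆-size {s = s} h)
⊆-size {s = true ∷ s} {true ∷ t} h = s≤s (⊆-size {s = s} h)

size≤n : ∀ {n} (s : Vec Bool n) → size s ≤ n
size≤n [] = z≤n
size≤n (true ∷ s) = s≤s (size≤n s)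
size≤n (false ∷ s) = m≤n⇒m≤1+n (size≤n s)

size-map : ∀ {A : Set} {P : A → Set} (P? : Decidable P) {n} (v : Vec A n) →
  size (V.map (λ a → does (P? a)) v) ≡ V.count P? v
size-map P? [] = refl
size-map P? (x ∷ v) with P? x
... | yes _ = cong suc (size-map P? v)
... | no _ = size-map P? v

count-members : ∀ {n} (T : Vec Bool n) → count (λ x → lookup T x BP.≟ true) (finList n) ≡ size T
count-members [] = refl
count-members {suc n} (b ∷ T) = begin
  count (member? (b ∷ T)) (finList (suc n))
    ≡⟨ cong (count (member? (b ∷ T))) (finList-suc n) ⟩
  count (member? (b ∷ T)) (zero ∷ map suc (finList n))
    ≡⟨ count-∷ (member? (b ∷ T)) zero (map suc (finList n)) ⟩
  ind (b BP.≟ true) + count (member? (b ∷ T)) (map suc (finList n))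
    ≡⟨ cong (ind (b BP.≟ true) +_) (trans (count-map (member? (b ∷ T)) suc (finList n)) (count-members T)) ⟩
  ind (b BP.≟ true) + size T
    ≡⟨ head-contribution b ⟩
  size (b ∷ T) ∎
  where
  open ≡-Reasoning
  member? : ∀ {m} (U : Vec Bool m) (x : Fin m) → Dec (lookup U x ≡ true)
  member? U x = lookup U x BP.≟ true
  head-contribution : ∀ b → ind (b BP.≟ true) + size T ≡ size (b ∷ T)
  head-contribution true = refl
  head-contribution false = refl

size≡0-lookup : ∀ {n} (v : Vec Bool n) → size v ≡ 0 → ∀ x → lookup v x ≡ false
size≡0-lookup (false ∷ v) e zero = refl
size≡0-lookup (false ∷ v) e (suc x) = size≡0-lookup v e x
size≡0-lookup (true ∷ v) () x

lookup-size≡0 : ∀ {n} (v : Vec Bool n) → (∀ x → lookup v x ≡ false) → size v ≡ 0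
lookup-size≡0 [] h = refl
lookup-size≡0 (false ∷ v) h = lookup-size≡0 v (λ x → h (suc x))
lookup-size≡0 (true ∷ v) h with h zero
... | ()

size≢0 : ∀ {n} (v : Vec Bool n) x → lookup v x ≡ true → size v ≢ 0
size≢0 v x e z with trans (sym e) (size≡0-lookup v z x)
... | ()

find-member : ∀ {n k} (v : Vec Bool n) → size v ≡ suc k → Σ (Fin n) (λ x → lookup v x ≡ true)
find-member (true ∷ v) _ = zero , refl
find-member (false ∷ v) e with find-member v e
... | x , e' = suc x , e'

kSubsets : (n k : ℕ) → List (Vec Bool n)
kSubsets zero zero = [ [] ]
kSubsets zero (suc k) = []
kSubsets (suc n) zero = map (false ∷_) (kSubsets n zero)
kSubsets (suc n) (suc k) = map (false ∷_) (kSubsets n (suc k)) ++ map (true ∷_) (kSubsets n k)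

length-kSubsets : ∀ n k → length (kSubsets n k) ≡ n C k
length-kSubsets zero zero = refl
length-kSubsets zero (suc k) = sym (k>n⇒nCk≡0 {0} {suc k} (s≤s z≤n))
length-kSubsets (suc n) zero = trans (LP.length-map _ (kSubsets n zero)) (length-kSubsets n zero)
length-kSubsets (suc n) (suc k) = begin
  length (map (false ∷_) (kSubsets n (suc k)) ++ map (true ∷_) (kSubsets n k))
    ≡⟨ LP.length-++ (map (false ∷_) (kSubsets n (suc k))) ⟩
  length (map (false ∷_) (kSubsets n (suc k))) + length (map (true ∷_) (kSubsets n k))
    ≡⟨ cong₂ _+_ (trans (LP.length-map _ (kSubsets n (suc k))) (length-kSubsets n (suc k))) (trans (LP.length-map _ (kSubsets n k)) (length-kSubsets n k)) ⟩
  n C suc k + n C k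
    ≡⟨ +-comm (n C suc k) (n C k) ⟩
  n C k + n C suc k
    ≡⟨ nCk+nC[k+1]≡[n+1]C[k+1] n k ⟩
  suc n C suc k ∎
  where open ≡-Reasoning

kSubsets-size : ∀ n k {t} → t ∈ kSubsets n k → size t ≡ k
kSubsets-size zero zero (here refl) = refl
kSubsets-size (suc n) zero m with MP.∈-map⁻ _ m
... | t' , m' , refl = kSubsets-size n zero m'
kSubsets-size (suc n) (suc k) m with MP.∈-++⁻ (map (false ∷_) (kSubsets n (suc k))) m
... | inj₁ m1 with MP.∈-map⁻ _ m1
...   | t' , m' , refl = kSubsets-size n (suc k) m'
kSubsets-size (suc n) (suc k) m | inj₂ m2 with MP.∈-map⁻ _ m2
...   | t' , m' , refl = cong suc (kSubsets-size n k m')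

kSubset-cover : ∀ n k (s : Vec Bool n) → size s ≤ k → k ≤ n → ∃ λ t → t ∈ kSubsets n k × s ⊆ t
kSubset-cover zero zero [] _ _ = [] , here refl , tt
kSubset-cover (suc n) zero (false ∷ s) a b with kSubset-cover n zero s a z≤n
... | t , m , h = false ∷ t , MP.∈-map⁺ _ m , h
kSubset-cover (suc n) (suc k) (true ∷ s) (s≤s a) (s≤s b) with kSubset-cover n k s a b
... | t , m , h = true ∷ t , MP.∈-++⁺ʳ (map (false ∷_) (kSubsets n (suc k))) (MP.∈-map⁺ _ m) , h
kSubset-cover (suc n) (suc k) (false ∷ s) a (s≤s b) with m≤n⇒m<n∨m≡n b
... | inj₁ k<n with kSubset-cover n (suc k) s a k<n
...   | t , m , h = false ∷ t , MP.∈-++⁺ˡ (MP.∈-map⁺ _ m) , h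
kSubset-cover (suc n) (suc k) (false ∷ s) a (s≤s b) | inj₂ refl with kSubset-cover n k s (≤-trans (size≤n s) ≤-refl) ≤-refl
... | t , m , h = true ∷ t , MP.∈-++⁺ʳ (map (false ∷_) (kSubsets n (suc k))) (MP.∈-map⁺ _ m) , h

count-kSubsets-⊇-large : ∀ n k (s : Vec Bool n) → k < size s → count (s ⊆?_) (kSubsets n k) ≡ 0
count-kSubsets-⊇-large n k s k<s = count-none (s ⊆?_) (kSubsets n k) λ t m h → <⇒≱ k<s (subst (size s ≤_) (kSubsets-size n k m) (⊆-size {s = s} h))

count-kSubsets-⊇-exact : ∀ n k (s : Vec Bool n) → size s ≡ k → count (s ⊆?_) (kSubsets n k) ≡ 1
count-kSubsets-⊇-exact zero zero [] refl = refl
count-kSubsets-⊇-exact (suc n) zero (false ∷ s) e = trans (count-map ((false ∷ s) ⊆?_) (false ∷_) (kSubsets n zero)) (count-kSubsets-⊇-exact n zero s e)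
count-kSubsets-⊇-exact (suc n) (suc k) (true ∷ s) refl =
  trans (count-++ ((true ∷ s) ⊆?_) (map (false ∷_) (kSubsets n (suc k))) _)
    (cong₂ _+_ (trans (count-map ((true ∷ s) ⊆?_) (false ∷_) (kSubsets n (suc k))) (count-none (λ t → true ∷ s ⊆? (false ∷ t)) (kSubsets n (suc k)) (λ _ _ ())))
               (trans (count-map ((true ∷ s) ⊆?_) (true ∷_) (kSubsets n k)) (count-kSubsets-⊇-exact n k s refl)))
count-kSubsets-⊇-exact (suc n) (suc k) (false ∷ s) e =
  trans (count-++ ((false ∷ s) ⊆?_) (map (false ∷_) (kSubsets n (suc k))) _)
    (cong₂ _+_ (trans (count-map ((false ∷ s) ⊆?_) (false ∷_) (kSubsets n (suc k))) (count-kSubsets-⊇-exact n (suc k) s e))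
               (trans (count-map ((false ∷ s) ⊆?_) (true ∷_) (kSubsets n k)) (count-kSubsets-⊇-large n k s (≤-reflexive (sym e)))))

module BijectionCount (n : ℕ) (w g : ℕ → ℕ)
  (w< : ∀ p → p < n → w p < n)
  (winj : ∀ p q → p < n → q < n → w p ≡ w q → p ≡ q)
  (g< : ∀ m → m < n → g m < n) (wg : ∀ m → m < n → w (g m) ≡ m) where

  count-w< : ∀ W → W ≤ n → count (λ p → w p <? W) (upTo n) ≡ W
  count-w< W W≤n = ≤-antisym
    (subst (count (λ p → w p <? W) (upTo n) ≤_) (LP.length-upTo W)
      (count-≤-by-injection _≟_ (λ p → w p <? W) (upTo n) (upTo W) w (UP.upTo⁺ n)
        (λ mx my _ _ e → winj _ _ (MP.∈-upTo⁻ mx) (MP.∈-upTo⁻ my) e)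
        (λ _ lt → MP.∈-upTo⁺ lt)))
    (subst (_≤ count (λ p → w p <? W) (upTo n)) (trans (count-all (λ _ → yes tt) (upTo W) (λ _ → tt)) (LP.length-upTo W))
      (count-≤-by-injection _≟_ (λ _ → yes tt) (upTo W) (filter (λ p → w p <? W) (upTo n)) g (UP.upTo⁺ W)
        (λ {x} {y} mx my _ _ e → trans (sym (wg x (lt mx))) (trans (cong w e) (wg y (lt my))))
        (λ {x} mx _ → MP.∈-filter⁺ (λ p → w p <? W) (MP.∈-upTo⁺ (g< x (lt mx))) (subst (_< W) (sym (wg x (lt mx))) (MP.∈-upTo⁻ mx)))))
    where
    lt : ∀ {x} → x ∈ upTo W → x < n
    lt mx = <-≤-trans (MP.∈-upTo⁻ mx) W≤n

-- Block structure of [0, ∞) determined by start flags st (st 0 = true):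
-- blockStart p is the last start ≤ p, the first position of p's block.
module BlockStarts (st : ℕ → Bool) (st-0 : st 0 ≡ true) where
  blockStart : ℕ → ℕ
  blockStart zero = zero
  blockStart (suc p) = if st (suc p) then suc p else blockStart p

  blockStart≤ : ∀ p → blockStart p ≤ p
  blockStart≤ zero = z≤n
  blockStart≤ (suc p) with st (suc p)
  ... | true = ≤-refl
  ... | false = m≤n⇒m≤1+n (blockStart≤ p)

  blockStart-isStart : ∀ p → st (blockStart p) ≡ true
  blockStart-isStart zero = st-0
  blockStart-isStart (suc p) with st (suc p) in e
  ... | true = e
  ... | false = blockStart-isStart p

  no-start-after-blockStart : ∀ p q → blockStart p < q → q ≤ p → st q ≡ false
  no-start-after-blockStart zero q lt le = ⊥-elim (<⇒≱ lt le)
  no-start-after-blockStart (suc p) q lt le with st (suc p) in e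
  ... | true = ⊥-elim (<⇒≱ lt le)
  ... | false with m≤n⇒m<n∨m≡n le
  ...   | inj₁ q<sp = no-start-after-blockStart p q lt (s≤s⁻¹ q<sp)
  ...   | inj₂ refl = e

  blockStart-unique : ∀ s q → st s ≡ true → s ≤ q → (∀ r → s < r → r ≤ q → st r ≡ false) → blockStart q ≡ s
  blockStart-unique s zero sts le h with n≤0⇒n≡0 le
  ... | refl = refl
  blockStart-unique s (suc q) sts le h with m≤n⇒m<n∨m≡n le
  ... | inj₂ refl rewrite sts = refl
  blockStart-unique s (suc q) sts le h | inj₁ s<sq rewrite h (suc q) s<sq ≤-refl =
    blockStart-unique s q sts (s≤s⁻¹ s<sq) (λ r a b → h r a (m≤n⇒m≤1+n b))

-- Let w be a bijection of [0,n) with w 0 = 0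
-- that increases by exactly one from p to p+1 whenever p+1 is not a start.
-- Then w is determined by the relative order ("rank") of the values w s at
-- the starts s: w is affine on every block, and w s for a start s is the
-- total length of the blocks whose start has a smaller value.
module Blocks (n : ℕ) (st : ℕ → Bool) (st-0 : st 0 ≡ true) (w g : ℕ → ℕ)
  (w< : ∀ p → p < n → w p < n)
  (winj : ∀ p q → p < n → q < n → w p ≡ w q → p ≡ q)
  (g< : ∀ m → m < n → g m < n) (wg : ∀ m → m < n → w (g m) ≡ m)
  (wstep : ∀ p → suc p < n → st (suc p) ≡ false → w (suc p) ≡ suc (w p))
  (w0 : w 0 ≡ 0) where

  open BijectionCount n w g w< winj g< wg
  open BlockStarts st st-0 public

  w-from-blockStart : ∀ p → p < n → w p ≡ w (blockStart p) + (p ∸ blockStart p)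
  w-from-blockStart zero _ = sym (+-identityʳ _)
  w-from-blockStart (suc p) sp<n with st (suc p) in e
  ... | true = trans (sym (+-identityʳ _)) (cong (w (suc p) +_) (sym (n∸n≡0 p)))
  ... | false = begin
      w (suc p) ≡⟨ wstep p sp<n e ⟩
      suc (w p) ≡⟨ cong suc (w-from-blockStart p (<-trans (n<1+n p) sp<n)) ⟩
      suc (w (blockStart p) + (p ∸ blockStart p)) ≡⟨ sym (+-suc _ _) ⟩
      w (blockStart p) + suc (p ∸ blockStart p) ≡⟨ cong (w (blockStart p) +_) (sym (+-∸-assoc 1 (blockStart≤ p))) ⟩
      w (blockStart p) + (suc p ∸ blockStart p) ∎
    where open ≡-Reasoning

  -- w<⇒blockStart< property
  -- For a start s, w p < w s iff w (blockStart p) < w s: since w is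
  -- injective and affine on blocks, the value w s cannot occur strictly
  -- inside p's block.
  w<⇒blockStart< : ∀ s p → st s ≡ true → s < n → p < n → w p < w s → w (blockStart p) < w s
  w<⇒blockStart< s p sts s<n p<n lt = ≤-<-trans (subst (w (blockStart p) ≤_) (sym (w-from-blockStart p p<n)) (m≤m+n _ _)) lt

  w-within-block : ∀ p q → blockStart p ≤ q → q ≤ p → p < n → w q ≡ w (blockStart p) + (q ∸ blockStart p)
  w-within-block p q a b p<n = trans (w-from-blockStart q (≤-<-trans b p<n)) (cong (λ z → w z + (q ∸ z)) e)
    where e : blockStart q ≡ blockStart p
          e = blockStart-unique (blockStart p) q (blockStart-isStart p) a (λ r x y → no-start-after-blockStart p r x (≤-trans y b))

  blockStart<⇒w< : ∀ s p → st s ≡ true → s < n → p < n → w (blockStart p) < w s → w p < w s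
  blockStart<⇒w< s p sts s<n p<n lt with w p <? w s
  ... | yes a = a
  ... | no ¬a = ⊥-elim (true≢false (trans (sym sts) (no-start-after-blockStart p s bs<s s≤p)))
    where
    b = blockStart p
    ws≤wp : w s ≤ w p
    ws≤wp = ≮⇒≥ ¬a
    m = w s ∸ w b
    m≤ : m ≤ p ∸ b
    m≤ = subst (λ z → w s ∸ w b ≤ z) (m+n∸m≡n (w b) (p ∸ b))
           (∸-monoˡ-≤ (w b) (subst (w s ≤_) (w-from-blockStart p p<n) ws≤wp))
    q = b + m
    q≤p : q ≤ p
    q≤p = subst (q ≤_) (m+[n∸m]≡n (blockStart≤ p)) (+-monoʳ-≤ b m≤)
    wq : w q ≡ w s
    wq = trans (w-within-block p q (m≤m+n b m) q≤p p<n) (trans (cong (w b +_) (m+n∸m≡n b m)) (m+[n∸m]≡n (<⇒≤ lt)))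
    qs : q ≡ s
    qs = winj q s (≤-<-trans q≤p p<n) s<n wq
    bs<s : b < s
    bs<s = subst (b <_) qs (subst (_≤ b + m) (+-comm b 1) (+-monoʳ-≤ b (m<n⇒0<n∸m lt)))
    s≤p : s ≤ p
    s≤p = subst (_≤ p) qs q≤p

  start? : ∀ p → Dec (st p ≡ true)
  start? p = st p BP.≟ true

  rank : ℕ → ℕ
  rank s = count (λ s' → start? s' ×-dec (w s' <? w s)) (upTo n)

  rank-mono : ∀ s s' → s < n → st s ≡ true → w s < w s' → rank s < rank s'
  rank-mono s s' s<n st' lt = count-mono< (λ s'' → start? s'' ×-dec (w s'' <? w s)) (λ s'' → start? s'' ×-dec (w s'' <? w s')) (upTo n)
    (λ x _ (a , b) → a , <-trans b lt) (MP.∈-upTo⁺ s<n) (st' , lt) (λ (_ , b) → <-irrefl refl b)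

  rank-reflects-< : ∀ s s' → s < n → s' < n → st s ≡ true → st s' ≡ true → rank s < rank s' → w s < w s'
  rank-reflects-< s s' s<n s'<n sts sts' lt with <-cmp (w s) (w s')
  ... | tri< a _ _ = a
  ... | tri≈ _ b _ rewrite winj s s' s<n s'<n b = ⊥-elim (<-irrefl refl lt)
  ... | tri> _ _ c = ⊥-elim (<-asym lt (rank-mono s' s s'<n sts' c))

  rank-inj : ∀ s s' → s < n → s' < n → st s ≡ true → st s' ≡ true → rank s ≡ rank s' → s ≡ s'
  rank-inj s s' s<n s'<n sts sts' e with <-cmp (w s) (w s')
  ... | tri< a _ _ = ⊥-elim (<-irrefl e (rank-mono s s' s<n sts a))
  ... | tri≈ _ b _ = winj s s' s<n s'<n b
  ... | tri> _ _ c = ⊥-elim (<-irrefl (sym e) (rank-mono s' s s'<n sts' c))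

  rank<#starts : ∀ s → s < n → st s ≡ true → rank s < count start? (upTo n)
  rank<#starts s s<n sts = count-mono< (λ s' → start? s' ×-dec (w s' <? w s)) start? (upTo n) (λ _ _ (a , _) → a)
    (MP.∈-upTo⁺ s<n) sts (λ (_ , b) → <-irrefl refl b)

  rank0 : rank 0 ≡ 0
  rank0 = count-none (λ s' → start? s' ×-dec (w s' <? w 0)) (upTo n)
    (λ x _ (_ , b) → n≮0 (subst (w x <_) w0 b))

  rank-pos : ∀ s → 0 < n → s < n → s ≢ 0 → 1 ≤ rank s
  rank-pos s 0<n s<n s≢0 = count-pos (λ s' → start? s' ×-dec (w s' <? w s)) (MP.∈-upTo⁺ 0<n) (st-0 , lt)
    where
    lt : w 0 < w s
    lt = subst (_< w s) (sym w0) (n≢0⇒n>0 λ e → s≢0 (sym (winj 0 s 0<n s<n (trans w0 (sym e)))))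

  w-start-from-ranks : ∀ s → s < n → st s ≡ true → w s ≡ count (λ p → rank (blockStart p) <? rank s) (upTo n)
  w-start-from-ranks s s<n sts = begin
    w s ≡⟨ sym (count-w< (w s) (<⇒≤ (w< s s<n))) ⟩
    count (λ p → w p <? w s) (upTo n)
      ≡⟨ count-cong (λ p → w p <? w s) (λ p → w (blockStart p) <? w s) (upTo n)
           (λ p m lt → w<⇒blockStart< s p sts s<n (MP.∈-upTo⁻ m) lt) (λ p m lt → blockStart<⇒w< s p sts s<n (MP.∈-upTo⁻ m) lt) ⟩
    count (λ p → w (blockStart p) <? w s) (upTo n)
      ≡⟨ count-cong (λ p → w (blockStart p) <? w s) (λ p → rank (blockStart p) <? rank s) (upTo n)
           (λ p m lt → rank-mono (blockStart p) s (≤-<-trans (blockStart≤ p) (MP.∈-upTo⁻ m)) (blockStart-isStart p) lt)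
           (λ p m lt → rank-reflects-< (blockStart p) s (≤-<-trans (blockStart≤ p) (MP.∈-upTo⁻ m)) s<n (blockStart-isStart p) sts lt) ⟩
    count (λ p → rank (blockStart p) <? rank s) (upTo n) ∎
    where open ≡-Reasoning

-- An injective table is surjective (punchOut turns a missed value into
-- an injection Fin (suc n) → Fin n).
perm-surjective : ∀ {n} (α : Tab n) → IsPerm α → ∀ y → Σ (Fin n) (λ x → app α x ≡ y)
perm-surjective {suc n'} α hα y with FP.any? (λ x → app α x FP.≟ y)
... | yes w = w
... | no ¬w = ⊥-elim (<-irrefl refl (FP.injective⇒≤ {f = h} hinj))
  where
  h : Fin (suc n') → Fin n'
  h x = punchOut {i = y} {j = app α x} (λ e → ¬w (x , sym e))
  hinj : ∀ {x x'} → h x ≡ h x' → x ≡ x'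
  hinj {x} {x'} e = hα _ _ (FP.punchOut-injective {i = y} (λ e → ¬w (x , sym e)) (λ e → ¬w (x' , sym e)) e)

disagree : ∀ {n} (β α : Tab n) → Vec Bool n
disagree {n} β α = V.map (λ a → does (¬? (app (α ∘ₚ β) a FP.≟ app (β ∘ₚ α) a))) (V.allFin n)

app-∘ : ∀ {n} (σ τ : Tab n) x → app (σ ∘ₚ τ) x ≡ app σ (app τ x)
app-∘ σ τ x = VP.lookup∘tabulate (λ a → app σ (app τ a)) x

disagree-lookup : ∀ {n} (β α : Tab n) x → lookup (disagree β α) x ≡ does (¬? (app (α ∘ₚ β) x FP.≟ app (β ∘ₚ α) x))
disagree-lookup {n} β α x = trans (VP.lookup-map x _ (V.allFin n)) (cong (λ z → does (¬? (app (α ∘ₚ β) z FP.≟ app (β ∘ₚ α) z))) (VP.lookup-allFin x))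

∉disagree⇒commute : ∀ {n} (β α : Tab n) x → lookup (disagree β α) x ≡ false → app α (app β x) ≡ app β (app α x)
∉disagree⇒commute β α x e with app (α ∘ₚ β) x FP.≟ app (β ∘ₚ α) x | disagree-lookup β α x
... | yes eq | _ = trans (sym (app-∘ α β x)) (trans eq (app-∘ β α x))
... | no _ | e' = ⊥-elim (true≢false (trans (sym e') e))

H : ∀ {n} → Tab n → Tab n → ℕ
H β α = hamming (α ∘ₚ β) (β ∘ₚ α)

H≡size : ∀ {n} (β α : Tab n) → H β α ≡ size (disagree β α)
H≡size {n} β α = sym (size-map (λ a → ¬? (app (α ∘ₚ β) a FP.≟ app (β ∘ₚ α) a)) (V.allFin n))

commute⇒∉disagree : ∀ {n} (β α : Tab n) x → app α (app β x) ≡ app β (app α x) → lookup (disagree β α) x ≡ false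
commute⇒∉disagree β α x e with app (α ∘ₚ β) x FP.≟ app (β ∘ₚ α) x | disagree-lookup β α x
... | yes _ | e' = e'
... | no ne | _ = ⊥-elim (ne (trans (app-∘ α β x) (trans e (sym (app-∘ β α x)))))

¬commute⇒∈disagree : ∀ {n} (β α : Tab n) x → app α (app β x) ≢ app β (app α x) → lookup (disagree β α) x ≡ true
¬commute⇒∈disagree β α x ne with app (α ∘ₚ β) x FP.≟ app (β ∘ₚ α) x | disagree-lookup β α x
... | yes e | _ = ⊥-elim (ne (trans (sym (app-∘ α β x)) (trans e (app-∘ β α x))))
... | no _ | e' = e'

nth : List ℕ → ℕ → ℕ
nth [] _ = 0
nth (x ∷ xs) zero = x
nth (x ∷ xs) (suc i) = nth xs i

nth-∈ : ∀ xs i → i < length xs → nth xs i ∈ xs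
nth-∈ (x ∷ xs) zero _ = here refl
nth-∈ (x ∷ xs) (suc i) (s≤s lt) = there (nth-∈ xs i lt)

nth-inj : ∀ xs → Unique xs → ∀ i j → i < length xs → j < length xs → nth xs i ≡ nth xs j → i ≡ j
nth-inj (x ∷ xs) u zero zero _ _ _ = refl
nth-inj (x ∷ xs) (a ∷ u) zero (suc j) _ (s≤s lt) e = ⊥-elim (All.lookup a (nth-∈ xs j lt) e)
nth-inj (x ∷ xs) (a ∷ u) (suc i) zero (s≤s lt) _ e = ⊥-elim (All.lookup a (nth-∈ xs i lt) (sym e))
nth-inj (x ∷ xs) (a ∷ u) (suc i) (suc j) (s≤s l1) (s≤s l2) e = cong suc (nth-inj xs u i j l1 l2 e)

nth-surj : ∀ {x} xs → x ∈ xs → Σ ℕ (λ i → i < length xs × nth xs i ≡ x)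
nth-surj (y ∷ xs) (here refl) = 0 , s≤s z≤n , refl
nth-surj (y ∷ xs) (there m) with nth-surj xs m
... | i , lt , e = suc i , s≤s lt , e

-- A total map ℕ → Fin (suc m) that is the identity below the bound; used
-- to tabulate vectors whose entries are only known to be in range.
clamp : (m : ℕ) → ℕ → Fin (suc m)
clamp zero _ = zero
clamp (suc m) zero = zero
clamp (suc m) (suc x) = suc (clamp m x)

clamp-ok : ∀ m x → x ≤ m → toℕ (clamp m x) ≡ x
clamp-ok zero zero _ = refl
clamp-ok (suc m) zero _ = refl
clamp-ok (suc m) (suc x) (s≤s le) = cong suc (clamp-ok m x le)

clampF : ∀ {m} → Fin m → ℕ → Fin m
clampF {suc m} _ x = clamp m x

clampF-ok : ∀ {m} (j : Fin m) x → x < m → toℕ (clampF j x) ≡ x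
clampF-ok {suc m} j x (s≤s le) = clamp-ok m x le

-- Fix a nonempty T ⊆ [n] of size k = k'+1
-- and a member x₁ of T.  Walk around the cycle from c = β x₁: position p is
-- pos p = β^p c, and a block starts at p = 0 and right after every point of
-- T.  For α in the class of T (α commutes with β off T) the relative
-- position relPos α p of α(pos p) seen from α(c) is a bijection of [0,n)
-- satisfying the hypotheses of 'Blocks'.  So α is determined by α(c) and the
-- ranks of the k' non-initial block starts, which form a permutation of
-- [k']: the class has at most n · k'! elements.
module ClassEncoding {n'} (β : Tab (suc n')) (hβ : IsNCycle β) (k' : ℕ) (T : Vec Bool (suc n')) (hT : size T ≡ suc k')
           (x₁ : Fin (suc n')) (hx₁ : lookup T x₁ ≡ true) where
  open NCycle β hβ

  c : Fin n
  c = app β x₁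

  pos : ℕ → Fin n
  pos p = iter β p c

  st : ℕ → Bool
  st zero = true
  st (suc p) = lookup T (pos p)

  open BlockStarts st refl

  start? : ∀ p → Dec (st p ≡ true)
  start? p = st p BP.≟ true

  pos-steps : ∀ x → pos (steps c x) ≡ x
  pos-steps x = iter-steps c x

  pos-inj : ∀ {p q} → p < n → q < n → pos p ≡ pos q → p ≡ q
  pos-inj = iter-uniq

  pos-count : ∀ {P : Fin n → Set} (P? : Decidable P) → count (λ p → P? (pos p)) (upTo n) ≡ count P? (finList n)
  pos-count {P} P? = ≤-antisym
    (count-≤-by-injection FP._≟_ (λ p → P? (pos p)) (upTo n) (filter P? (finList n)) pos (UP.upTo⁺ n)
      (λ mx my _ _ e → pos-inj (MP.∈-upTo⁻ mx) (MP.∈-upTo⁻ my) e) (λ _ px → MP.∈-filter⁺ P? (∈-finList _) px))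
    (count-≤-by-injection _≟_ P? (finList n) (filter (λ p → P? (pos p)) (upTo n)) (steps c) (unique-finList n)
      (λ {x} {y} _ _ _ _ e → trans (sym (pos-steps x)) (trans (cong pos e) (pos-steps y)))
      (λ {x} _ px → MP.∈-filter⁺ (λ p → P? (pos p)) (MP.∈-upTo⁺ (steps-< c x)) (subst P (sym (pos-steps x)) px)))

  pos-n' : pos n' ≡ x₁
  pos-n' = trans (sym (iter-+ n' 1 x₁)) (trans (cong (λ z → iter β z x₁) (+-comm n' 1)) (iter-n x₁))

  inT? : ∀ p → Dec (lookup T (pos p) ≡ true)
  inT? p = lookup T (pos p) BP.≟ true

  -- There are k = k'+1 block starts: 0, and p+1 for each p < n-1 with
  -- pos p ∈ T (the last position n-1 is x₁ ∈ T itself).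
  #starts≡k : count start? (upTo n) ≡ suc k'
  #starts≡k = cong suc (trans (cong (count start?) (sym (LP.map-applyUpTo (λ i → i) suc n'))) (trans (count-map start? suc (upTo n')) inT-before-last))
    where
    last-inT : count inT? (n' ∷ []) ≡ 1
    last-inT with inT? n'
    ... | yes _ = refl
    ... | no ¬p = ⊥-elim (¬p (trans (cong (lookup T) pos-n') hx₁))
    inT-with-last : count inT? (upTo n') + 1 ≡ suc k'
    inT-with-last = begin
      count inT? (upTo n') + 1                        ≡⟨ cong (count inT? (upTo n') +_) (sym last-inT) ⟩
      count inT? (upTo n') + count inT? (n' ∷ [])     ≡⟨ sym (count-++ inT? (upTo n') (n' ∷ [])) ⟩
      count inT? (upTo n' ++ n' ∷ [])                 ≡⟨ cong (count inT?) (LP.upTo-∷ʳ n') ⟩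
      count inT? (upTo n)                             ≡⟨ pos-count (λ x → lookup T x BP.≟ true) ⟩
      count (λ x → lookup T x BP.≟ true) (finList n)  ≡⟨ count-members T ⟩
      size T                                          ≡⟨ hT ⟩
      suc k'                                          ∎
      where open ≡-Reasoning
    inT-before-last : count inT? (upTo n') ≡ k'
    inT-before-last = suc-injective (trans (+-comm 1 _) inT-with-last)

  relPos : Tab n → ℕ → ℕ
  relPos α p = steps (app α c) (app α (pos p))

  blockRank : Tab n → ℕ → ℕ
  blockRank α s = count (λ s' → start? s' ×-dec (relPos α s' <? relPos α s)) (upTo n)

  InClass : Tab n → Set
  InClass α = IsPerm α × (∀ x → lookup T x ≡ false → app α (app β x) ≡ app β (app α x))

  module BlockData (α : Tab n) (Gα : InClass α) where
    v : Fin n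
    v = app α c
    perm = proj₁ Gα
    comm = proj₂ Gα
    αinv : Fin n → Fin n
    αinv y = proj₁ (perm-surjective α perm y)
    w = relPos α
    g : ℕ → ℕ
    g m = steps c (αinv (iter β m v))
    αpos : ∀ p → app α (pos p) ≡ iter β (w p) v
    αpos p = sym (iter-steps v _)
    w< : ∀ p → p < n → w p < n
    w< p _ = steps-< v _
    winj : ∀ p q → p < n → q < n → w p ≡ w q → p ≡ q
    winj p q p<n q<n e = pos-inj p<n q<n (perm _ _ (trans (αpos p) (trans (cong (λ z → iter β z v) e) (sym (αpos q)))))
    g< : ∀ m → m < n → g m < n
    g< m _ = steps-< c _
    wg : ∀ m → m < n → w (g m) ≡ m
    wg m m<n = trans (cong (steps v) (trans (cong (app α) (pos-steps _)) (proj₂ (perm-surjective α perm _)))) (sym (steps-unique m<n refl))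
    wstep : ∀ p → suc p < n → st (suc p) ≡ false → w (suc p) ≡ suc (w p)
    wstep p sp<n e with m≤n⇒m<n∨m≡n (w< p (<-trans (n<1+n p) sp<n))
    ... | inj₁ lt = sym (steps-unique lt (trans (cong (app β) (sym (αpos p))) (sym (comm (pos p) e))))
    ... | inj₂ eq = ⊥-elim (1+n≢0 (pos-inj sp<n (s≤s z≤n) (perm _ _ chain)))
      where
      chain : app α (pos (suc p)) ≡ app α (pos 0)
      chain = trans (comm (pos p) e) (trans (cong (app β) (αpos p)) (trans (cong (λ z → iter β z v) eq) (iter-n v)))
    w0 : w 0 ≡ 0
    w0 = steps-self v
    open Blocks n st refl w g w< winj g< wg wstep w0 public

  starts : List ℕ
  starts = filter start? (upTo n)

  unique-starts : Unique starts
  unique-starts = UP.filter⁺ start? (UP.upTo⁺ n)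

  starts-valid : ∀ i → i < length starts → st (nth starts i) ≡ true × nth starts i < n
  starts-valid i lt = let (a , b) = MP.∈-filter⁻ start? (nth-∈ starts i lt) in b , MP.∈-upTo⁻ a

  encode : Tab n → Tab k'
  encode α = tabulate (λ j → clampF j (blockRank α (nth starts (suc (toℕ j))) ∸ 1))

  private
    pred< : ∀ a b → 1 ≤ a → a ≤ b → a ∸ 1 < b
    pred< (suc a) b _ le = le
    pred-inj : ∀ a b → 1 ≤ a → 1 ≤ b → a ∸ 1 ≡ b ∸ 1 → a ≡ b
    pred-inj (suc a) (suc b) _ _ e = cong suc e

  module EncodingFacts (α : Tab n) (Gα : InClass α) where
    open BlockData α Gα

    later-start-index : ∀ j → j < k' → suc j < length starts
    later-start-index j lt = subst (suc j <_) (sym #starts≡k) (s≤s lt)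

    later-start-valid : ∀ j → j < k' → st (nth starts (suc j)) ≡ true × nth starts (suc j) < n
    later-start-valid j lt = starts-valid (suc j) (later-start-index j lt)

    later-start≢0 : ∀ j → j < k' → nth starts (suc j) ≢ 0
    later-start≢0 j lt e = 1+n≢0 (nth-inj starts unique-starts (suc j) 0 (later-start-index j lt) (subst (0 <_) (sym #starts≡k) (s≤s z≤n)) e)

    blockRank≤k' : ∀ s → s < n → st s ≡ true → blockRank α s ≤ k'
    blockRank≤k' s s<n sts = s≤s⁻¹ (subst (blockRank α s <_) #starts≡k (rank<#starts s s<n sts))

    later-start-rank≥1 : ∀ j → j < k' → 1 ≤ blockRank α (nth starts (suc j))
    later-start-rank≥1 j lt = rank-pos _ (s≤s z≤n) (proj₂ (later-start-valid j lt)) (later-start≢0 j lt)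

    encode-value : ∀ (j : Fin k') → toℕ (lookup (encode α) j) ≡ blockRank α (nth starts (suc (toℕ j))) ∸ 1
    encode-value j = trans (cong toℕ (VP.lookup∘tabulate _ j))
      (clampF-ok j _ (pred< _ _ (later-start-rank≥1 (toℕ j) j<k') (blockRank≤k' _ (proj₂ valid) (proj₁ valid))))
      where
      j<k' = FP.toℕ<n j
      valid = later-start-valid (toℕ j) j<k'

    encode-perm : IsPerm (encode α)
    encode-perm i j e = FP.toℕ-injective (suc-injective
      (nth-inj starts unique-starts _ _ (later-start-index _ (FP.toℕ<n i)) (later-start-index _ (FP.toℕ<n j))
        (rank-inj _ _ (proj₂ (later-start-valid _ (FP.toℕ<n i))) (proj₂ (later-start-valid _ (FP.toℕ<n j)))
           (proj₁ (later-start-valid _ (FP.toℕ<n i))) (proj₁ (later-start-valid _ (FP.toℕ<n j)))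
           (pred-inj _ _ (later-start-rank≥1 _ (FP.toℕ<n i)) (later-start-rank≥1 _ (FP.toℕ<n j))
              (trans (sym (encode-value i)) (trans (cong toℕ e) (encode-value j)))))))

  encode-injective : ∀ α α' (Gα : InClass α) (Gα' : InClass α') → app α c ≡ app α' c → encode α ≡ encode α' → α ≡ α'
  encode-injective α α' Gα Gα' ev ee = vec-ext tables-agree
    where
    module A = BlockData α Gα
    module A' = BlockData α' Gα'
    module RA = EncodingFacts α Gα
    module RA' = EncodingFacts α' Gα'
    encoded-ranks-agree : ∀ j → j < k' → blockRank α (nth starts (suc j)) ≡ blockRank α' (nth starts (suc j))
    encoded-ranks-agree j lt = pred-inj _ _ (RA.later-start-rank≥1 j lt) (RA'.later-start-rank≥1 j lt)
      (trans (sym (trans (RA.encode-value jF) (cong (λ z → blockRank α (nth starts (suc z)) ∸ 1) tj)))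
        (trans (cong (λ e → toℕ (lookup e jF)) ee) (trans (RA'.encode-value jF) (cong (λ z → blockRank α' (nth starts (suc z)) ∸ 1) tj))))
      where
      jF : Fin k'
      jF = fromℕ< lt
      tj : toℕ jF ≡ j
      tj = FP.toℕ-fromℕ< lt
    ranks-agree : ∀ s → s < n → st s ≡ true → blockRank α s ≡ blockRank α' s
    ranks-agree s s<n sts with nth-surj starts (MP.∈-filter⁺ start? (MP.∈-upTo⁺ s<n) sts)
    ... | zero , _ , refl = trans A.rank0 (sym A'.rank0)
    ... | suc j , lt , refl = encoded-ranks-agree j (s≤s⁻¹ (subst (suc j <_) #starts≡k lt))
    w-agree-on-starts : ∀ s → s < n → st s ≡ true → relPos α s ≡ relPos α' s
    w-agree-on-starts s s<n sts = trans (A.w-start-from-ranks s s<n sts) (trans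
      (count-cong (λ p → blockRank α (blockStart p) <? blockRank α s) (λ p → blockRank α' (blockStart p) <? blockRank α' s) (upTo n)
        (λ p m lt → subst₂ _<_ (ranks-agree (blockStart p) (≤-<-trans (blockStart≤ p) (MP.∈-upTo⁻ m)) (blockStart-isStart p)) (ranks-agree s s<n sts) lt)
        (λ p m lt → subst₂ _<_ (sym (ranks-agree (blockStart p) (≤-<-trans (blockStart≤ p) (MP.∈-upTo⁻ m)) (blockStart-isStart p))) (sym (ranks-agree s s<n sts)) lt))
      (sym (A'.w-start-from-ranks s s<n sts)))
    w-agree : ∀ p → p < n → relPos α p ≡ relPos α' p
    w-agree p p<n = begin
      relPos α p                                     ≡⟨ A.w-from-blockStart p p<n ⟩
      relPos α (blockStart p) + (p ∸ blockStart p)   ≡⟨ cong (_+ (p ∸ blockStart p)) agree-at-start ⟩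
      relPos α' (blockStart p) + (p ∸ blockStart p)  ≡⟨ sym (A'.w-from-blockStart p p<n) ⟩
      relPos α' p                                    ∎
      where
      open ≡-Reasoning
      agree-at-start = w-agree-on-starts (blockStart p) (≤-<-trans (blockStart≤ p) p<n) (blockStart-isStart p)
    tables-agree : ∀ x → app α x ≡ app α' x
    tables-agree x = begin
      app α x ≡⟨ cong (app α) (sym (pos-steps x)) ⟩
      app α (pos p) ≡⟨ A.αpos p ⟩
      iter β (relPos α p) (app α c) ≡⟨ cong₂ (λ a b → iter β a b) (w-agree p (steps-< c x)) ev ⟩
      iter β (relPos α' p) (app α' c) ≡⟨ sym (A'.αpos p) ⟩
      app α' (pos p) ≡⟨ cong (app α') (pos-steps x) ⟩
      app α' x ∎
      where open ≡-Reasoning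
            p = steps c x

  isPerm-of : ∀ {α} → α ∈ allPerms n → IsPerm α
  isPerm-of m = proj₂ (MP.∈-filter⁻ isPerm? {xs = allVecs n n} m)

  inClass : ∀ {α} → α ∈ allPerms n → disagree β α ⊆ T → InClass α
  inClass {α} m h = isPerm-of m , commute-off-T
    where
    commute-off-T : ∀ x → lookup T x ≡ false → app α (app β x) ≡ app β (app α x)
    commute-off-T x e with lookup (disagree β α) x in e'
    ... | false = ∉disagree⇒commute β α x e'
    ... | true = ⊥-elim (true≢false (trans (sym (⊆-lookup {s = disagree β α} h x e')) e))

  codes : List (Fin n × Tab k')
  codes = concatMap (λ v → map (v ,_) (allPerms k')) (finList n)

  length-codes : length codes ≡ n * k' !
  length-codes = trans (length-pairs (finList n)) (cong (_* k' !) (length-finList n))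
    where
    length-pairs : ∀ xs → length (concatMap (λ v → map (v ,_) (allPerms k')) xs) ≡ length xs * k' !
    length-pairs [] = refl
    length-pairs (x ∷ xs) = trans (LP.length-++ (map (x ,_) (allPerms k'))) (cong₂ _+_ (trans (LP.length-map _ (allPerms k')) (length-allPerms k')) (length-pairs xs))

  class-upper-bound : count (λ α → disagree β α ⊆? T) (allPerms n) ≤ n * k' !
  class-upper-bound = subst (_ ≤_) length-codes
    (count-≤-by-injection (PP.≡-dec FP._≟_ vec≟) (λ α → disagree β α ⊆? T) (allPerms n) codes (λ α → app α c , encode α)
      (UP.filter⁺ isPerm? {xs = allVecs n n} (unique-allVecs n n))
      (λ {α} {α'} mα mα' hα hα' e → encode-injective α α' (inClass mα hα) (inClass mα' hα') (proj₁ (PP.,-injective e)) (proj₂ (PP.,-injective e)))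
      λ {α} mα hα → MP.∈-concatMap⁺ (λ v → map (v ,_) (allPerms k'))
        (Any.map (λ { refl → MP.∈-map⁺ (app α c ,_) (MP.∈-filter⁺ isPerm? (∈-allVecs k' k' (encode α)) (EncodingFacts.encode-perm α (inClass mα hα))) }) (∈-finList (app α c))))

-- Left multiplication by powers of β.  γ α j = β^j α keeps the
-- disagreement set of α (β^j commutes with β), and the n tables γ α j are
-- distinct; so any property of disagreement sets that holds for α holds for
-- at least n permutations.  For α = id this shows the centralizer of β has
-- n elements; it has at most n since a commuting α is determined by α(a₀).
module PowerOrbit {n'} (β : Tab (suc n')) (hβ : IsNCycle β) where
  open NCycle β hβ

  γ : Tab n → Fin n → Tab n
  γ α j = tabulate (λ x → iter β (toℕ j) (app α x))

  app-γ : ∀ α j x → app (γ α j) x ≡ iter β (toℕ j) (app α x)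
  app-γ α j x = VP.lookup∘tabulate (λ x → iter β (toℕ j) (app α x)) x

  γ-perm : ∀ α → IsPerm α → ∀ j → IsPerm (γ α j)
  γ-perm α hα j x y e = hα x y (β-iter-inj (toℕ j) (trans (sym (app-γ α j x)) (trans e (app-γ α j y))))

  γ-commute⇒ : ∀ α j x → app (γ α j) (app β x) ≡ app β (app (γ α j) x) → app α (app β x) ≡ app β (app α x)
  γ-commute⇒ α j x e = β-iter-inj (toℕ j) (trans (sym (app-γ α j (app β x))) (trans e (trans (cong (app β) (app-γ α j x)) (iter-comm 1 (toℕ j) (app α x)))))

  γ-commute⇐ : ∀ α j x → app α (app β x) ≡ app β (app α x) → app (γ α j) (app β x) ≡ app β (app (γ α j) x)
  γ-commute⇐ α j x e = trans (app-γ α j (app β x)) (trans (cong (iter β (toℕ j)) e) (trans (iter-comm (toℕ j) 1 (app α x)) (cong (app β) (sym (app-γ α j x)))))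

  disagree-γ : ∀ α j → disagree β (γ α j) ≡ disagree β α
  disagree-γ α j = vec-ext λ x → case x (app α (app β x) FP.≟ app β (app α x))
    where
    case : ∀ x → Dec (app α (app β x) ≡ app β (app α x)) → lookup (disagree β (γ α j)) x ≡ lookup (disagree β α) x
    case x (yes e) = trans (commute⇒∉disagree β (γ α j) x (γ-commute⇐ α j x e)) (sym (commute⇒∉disagree β α x e))
    case x (no ne) = trans (¬commute⇒∈disagree β (γ α j) x (λ e → ne (γ-commute⇒ α j x e))) (sym (¬commute⇒∈disagree β α x ne))

  orbit-lower-bound : ∀ α → IsPerm α → ∀ {P : Tab n → Set} (P? : Decidable P) → (∀ j → P (γ α j)) → n ≤ count P? (allPerms n)
  orbit-lower-bound α hα {P} P? hP = subst (_≤ count P? (allPerms n)) (trans (count-all (λ _ → yes tt) (finList n) (λ _ → tt)) (length-finList n))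
    (count-≤-by-injection vec≟ (λ _ → yes tt) (finList n) (filter P? (allPerms n)) (γ α) (unique-finList n)
      (λ {i} {j} _ _ _ _ e → FP.toℕ-injective (iter-uniq (FP.toℕ<n i) (FP.toℕ<n j)
          (trans (sym (app-γ α i a₀)) (trans (cong (λ t → app t a₀) e) (app-γ α j a₀)))))
      λ {j} _ _ → MP.∈-filter⁺ P? (MP.∈-filter⁺ isPerm? {xs = allVecs n n} (∈-allVecs n n (γ α j)) (γ-perm α hα j)) (hP j))

  idTab : Tab n
  idTab = V.allFin n

  idTab-perm : IsPerm idTab
  idTab-perm x y e = trans (sym (VP.lookup-allFin x)) (trans e (VP.lookup-allFin y))

  disagree-id : ∀ x → lookup (disagree β idTab) x ≡ false
  disagree-id x = commute⇒∉disagree β idTab x (trans (VP.lookup-allFin _) (cong (app β) (sym (VP.lookup-allFin x))))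

  commute-iter : ∀ α → (∀ x → app α (app β x) ≡ app β (app α x)) → ∀ m x → app α (iter β m x) ≡ iter β m (app α x)
  commute-iter α h zero x = refl
  commute-iter α h (suc m) x = trans (h (iter β m x)) (cong (app β) (commute-iter α h m x))

  -- A permutation commuting with β is determined by its value at a₀, since
  -- every point is β^m a₀.
  commuting-determined : ∀ α α' → (∀ x → app α (app β x) ≡ app β (app α x)) →
    (∀ x → app α' (app β x) ≡ app β (app α' x)) → app α a₀ ≡ app α' a₀ → α ≡ α'
  commuting-determined α α' h h' e = vec-ext agree
    where
    agree : ∀ x → app α x ≡ app α' x
    agree x = begin
      app α x                ≡⟨ cong (app α) (sym (proj₂ (orb x))) ⟩
      app α (iter β m a₀)    ≡⟨ commute-iter α h m a₀ ⟩
      iter β m (app α a₀)    ≡⟨ cong (iter β m) e ⟩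
      iter β m (app α' a₀)   ≡⟨ sym (commute-iter α' h' m a₀) ⟩
      app α' (iter β m a₀)   ≡⟨ cong (app α') (proj₂ (orb x)) ⟩
      app α' x               ∎
      where
      open ≡-Reasoning
      m = proj₁ (orb x)

  centralizer-size : count (λ α → H β α ≟ 0) (allPerms n) ≡ n
  centralizer-size = ≤-antisym at-most-n at-least-n
    where
    H≡0⇒commute : ∀ α → H β α ≡ 0 → ∀ x → app α (app β x) ≡ app β (app α x)
    H≡0⇒commute α h x = ∉disagree⇒commute β α x (size≡0-lookup (disagree β α) (trans (sym (H≡size β α)) h) x)
    at-most-n : count (λ α → H β α ≟ 0) (allPerms n) ≤ n
    at-most-n = subst (count (λ α → H β α ≟ 0) (allPerms n) ≤_) (length-finList n)
      (count-≤-by-injection FP._≟_ (λ α → H β α ≟ 0) (allPerms n) (finList n) (λ α → app α a₀)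
        (UP.filter⁺ isPerm? {xs = allVecs n n} (unique-allVecs n n))
        (λ {α} {α'} _ _ h h' e → commuting-determined α α' (H≡0⇒commute α h) (H≡0⇒commute α' h') e)
        (λ _ _ → ∈-finList _))
    at-least-n : n ≤ count (λ α → H β α ≟ 0) (allPerms n)
    at-least-n = orbit-lower-bound idTab idTab-perm (λ α → H β α ≟ 0)
      (λ j → trans (H≡size β (γ idTab j)) (trans (cong size (disagree-γ idTab j)) (lookup-size≡0 (disagree β idTab) disagree-id)))

-- The block permutation used for k = 3.  With block starts 0 < a < b < n,
-- w₁ keeps the block [0,a), and swaps the blocks [a,b) and [b,n): it is a
-- bijection of [0,n) (inverse u₁) that increases by one except at a and b,
-- and it does break at a.
module SwapLastBlocks (n a b : ℕ) (0<a : 0 < a) (a<b : a < b) (b<n : b < n) where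
  d : ℕ
  d = n ∸ b

  w₁ : ℕ → ℕ
  w₁ p with p <? a
  ... | yes _ = p
  ... | no _ with p <? b
  ...   | yes _ = p + d
  ...   | no _ = p ∸ b + a

  u₁ : ℕ → ℕ
  u₁ y with y <? a
  ... | yes _ = y
  ... | no _ with y <? a + d
  ...   | yes _ = y ∸ a + b
  ...   | no _ = y ∸ d

  wx : ∀ p → p < a → w₁ p ≡ p
  wx p lt with p <? a
  ... | yes _ = refl
  ... | no nl = ⊥-elim (nl lt)

  wy : ∀ p → a ≤ p → p < b → w₁ p ≡ p + d
  wy p le lt with p <? a
  ... | yes x = ⊥-elim (<⇒≱ x le)
  ... | no _ with p <? b
  ...   | yes _ = refl
  ...   | no nl = ⊥-elim (nl lt)

  wz : ∀ p → b ≤ p → w₁ p ≡ p ∸ b + a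
  wz p le with p <? a
  ... | yes x = ⊥-elim (<⇒≱ (<-trans x a<b) le)
  ... | no _ with p <? b
  ...   | yes x = ⊥-elim (<⇒≱ x le)
  ...   | no _ = refl

  ux : ∀ y → y < a → u₁ y ≡ y
  ux y lt with y <? a
  ... | yes _ = refl
  ... | no nl = ⊥-elim (nl lt)

  uz : ∀ y → a ≤ y → y < a + d → u₁ y ≡ y ∸ a + b
  uz y le lt with y <? a
  ... | yes x = ⊥-elim (<⇒≱ x le)
  ... | no _ with y <? a + d
  ...   | yes _ = refl
  ...   | no nl = ⊥-elim (nl lt)

  uy : ∀ y → a + d ≤ y → u₁ y ≡ y ∸ d
  uy y le with y <? a
  ... | yes x = ⊥-elim (<⇒≱ (<-≤-trans x (m≤m+n a d)) le)
  ... | no _ with y <? a + d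
  ...   | yes x = ⊥-elim (<⇒≱ x le)
  ...   | no _ = refl

  b+d : b + d ≡ n
  b+d = m+[n∸m]≡n (<⇒≤ b<n)

  0<d : 0 < d
  0<d = m<n⇒0<n∸m b<n

  uw : ∀ p → p < n → u₁ (w₁ p) ≡ p
  uw p p<n with p <? a
  ... | yes x = ux p x
  ... | no ¬x with p <? b
  ...   | yes y = trans (uy (p + d) (+-monoˡ-≤ d (≮⇒≥ ¬x))) (m+n∸n≡m p d)
  ...   | no ¬y = trans (uz (p ∸ b + a) (m≤n+m a _) lt) e
    where
    b≤p = ≮⇒≥ ¬y
    lt : p ∸ b + a < a + d
    lt = subst (p ∸ b + a <_) (+-comm d a) (+-monoˡ-< a (∸-monoˡ-< p<n b≤p))
    e : p ∸ b + a ∸ a + b ≡ p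
    e = trans (cong (_+ b) (m+n∸n≡m (p ∸ b) a)) (m∸n+n≡m b≤p)

  w-inj : ∀ p q → p < n → q < n → w₁ p ≡ w₁ q → p ≡ q
  w-inj p q p<n q<n e = trans (sym (uw p p<n)) (trans (cong u₁ e) (uw q q<n))

  w< : ∀ p → p < n → w₁ p < n
  w< p p<n with p <? a
  ... | yes _ = p<n
  ... | no ¬x with p <? b
  ...   | yes y = subst (p + d <_) b+d (+-monoˡ-< d y)
  ...   | no ¬y = ≤-trans (+-monoˡ-< a (∸-monoˡ-< p<n (≮⇒≥ ¬y))) (subst (_≤ n) (+-comm a d) (≤-trans (+-monoˡ-≤ d (<⇒≤ a<b)) (≤-reflexive b+d)))

  step : ∀ p → suc p < n → suc p ≢ a → suc p ≢ b → w₁ (suc p) ≡ suc (w₁ p)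
  step p sp<n na nb with <-cmp (suc p) a
  ... | tri< x _ _ = trans (wx (suc p) x) (cong suc (sym (wx p (<-trans (n<1+n p) x))))
  ... | tri≈ _ x _ = ⊥-elim (na x)
  ... | tri> _ _ a<sp with <-cmp (suc p) b
  ...   | tri< y _ _ = trans (wy (suc p) (<⇒≤ a<sp) y) (cong suc (sym (wy p (s≤s⁻¹ a<sp) (<-trans (n<1+n p) y))))
  ...   | tri≈ _ y _ = ⊥-elim (nb y)
  ...   | tri> _ _ b<sp = trans (wz (suc p) (<⇒≤ b<sp)) (trans (cong (_+ a) (+-∸-assoc 1 (s≤s⁻¹ b<sp))) (cong suc (sym (wz p (s≤s⁻¹ b<sp)))))

  -- w₁ jumps at a: w₁ a = a + d, while w₁ (a-1) = a-1.
  break : w₁ a ≢ suc (w₁ (a ∸ 1))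
  break e = <-irrefl (sym e') (m<m+n a 0<d)
    where
    a∸1<a : a ∸ 1 < a
    a∸1<a = ∸-monoʳ-< {a} {1} {0} (s≤s z≤n) 0<a
    sa : suc (a ∸ 1) ≡ a
    sa = m+[n∸m]≡n 0<a
    e' : a + d ≡ a
    e' = trans (sym (wy a ≤-refl a<b)) (trans e (trans (cong suc (wx (a ∸ 1) a∸1<a)) sa))

-- The lower bound for |T| = 3: realising the block swap above as a
-- permutation α₁ gives a noncommuting element of the class of T, and its n
-- left translates β^j α₁ are n distinct elements of the class.
module ClassOfThree {n'} (β : Tab (suc n')) (hβ : IsNCycle β) (T : Vec Bool (suc n')) (hT : size T ≡ 3)
           (x₁ : Fin (suc n')) (hx₁ : lookup T x₁ ≡ true) where
  open NCycle β hβ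
  open ClassEncoding β hβ 2 T hT x₁ hx₁
  open PowerOrbit β hβ

  three-starts : length starts ≡ 3
  three-starts = #starts≡k

  s1 s2 : ℕ
  s1 = nth starts 1
  s2 = nth starts 2

  s1-valid : st s1 ≡ true × s1 < n
  s1-valid = starts-valid 1 (subst (1 <_) (sym three-starts) (s≤s (s≤s z≤n)))

  s2-valid : st s2 ≡ true × s2 < n
  s2-valid = starts-valid 2 (subst (2 <_) (sym three-starts) (s≤s (s≤s (s≤s z≤n))))

  starts-distinct : ∀ i j → i < 3 → j < 3 → i ≢ j → nth starts i ≢ nth starts j
  starts-distinct i j li lj i≢j e =
    i≢j (nth-inj starts unique-starts i j (subst (i <_) (sym three-starts) li) (subst (j <_) (sym three-starts) lj) e)

  a b : ℕ
  a = s1 ⊓ s2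
  b = s1 ⊔ s2

  min-max-cases : ∀ {P : ℕ → Set} → P s1 → P s2 → ∀ {z} → (z ≡ s1 ⊎ z ≡ s2) → P z
  min-max-cases p1 p2 (inj₁ refl) = p1
  min-max-cases p1 p2 (inj₂ refl) = p2

  sta : st a ≡ true
  sta = min-max-cases {λ z → st z ≡ true} (proj₁ s1-valid) (proj₁ s2-valid) (⊓-sel s1 s2)

  stb : st b ≡ true
  stb = min-max-cases {λ z → st z ≡ true} (proj₁ s1-valid) (proj₁ s2-valid) (⊔-sel s1 s2)

  0<a : 0 < a
  0<a = min-max-cases {λ z → 0 < z}
    (n≢0⇒n>0 (starts-distinct 1 0 (s≤s (s≤s z≤n)) (s≤s z≤n) (λ ())))
    (n≢0⇒n>0 (starts-distinct 2 0 (s≤s (s≤s (s≤s z≤n))) (s≤s z≤n) (λ ()))) (⊓-sel s1 s2)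

  b<n : b < n
  b<n = min-max-cases {λ z → z < n} (proj₂ s1-valid) (proj₂ s2-valid) (⊔-sel s1 s2)

  a<b : a < b
  a<b = ≤∧≢⇒< (m⊓n≤m⊔n s1 s2) λ a≡b → starts-distinct 1 2 (s≤s (s≤s z≤n)) (s≤s (s≤s (s≤s z≤n))) (λ ()) (⊓≡⊔⇒≡ s1 s2 a≡b)
    where
    ⊓≡⊔⇒≡ : ∀ x y → x ⊓ y ≡ x ⊔ y → x ≡ y
    ⊓≡⊔⇒≡ x y e = ≤-antisym (≤-trans (≤-trans (m≤m⊔n x y) (≤-reflexive (sym e))) (m⊓n≤n x y))
                            (≤-trans (≤-trans (m≤n⊔m x y) (≤-reflexive (sym e))) (m⊓n≤m x y))

  module Witness (a b : ℕ) (0<a : 0 < a) (a<b : a < b) (b<n : b < n) (sta : st a ≡ true) (stb : st b ≡ true) where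
    open SwapLastBlocks n a b 0<a a<b b<n

    α₁ : Tab n
    α₁ = tabulate (λ x → iter β (w₁ (steps c x)) c)

    app₁ : ∀ x → app α₁ x ≡ iter β (w₁ (steps c x)) c
    app₁ x = VP.lookup∘tabulate (λ x → iter β (w₁ (steps c x)) c) x

    α₁-perm : IsPerm α₁
    α₁-perm x y e = trans (sym (pos-steps x)) (trans (cong pos
       (w-inj _ _ (steps-< c x) (steps-< c y) (iter-uniq (SwapLastBlocks.w< n a b 0<a a<b b<n _ (steps-< c x)) (SwapLastBlocks.w< n a b 0<a a<b b<n _ (steps-< c y))
          (trans (sym (app₁ x)) (trans e (app₁ y)))))) (pos-steps y))

    app₁-pos : ∀ p → p < n → app α₁ (pos p) ≡ iter β (w₁ p) c
    app₁-pos p p<n = trans (app₁ (pos p)) (cong (λ z → iter β (w₁ z) c) (sym (steps-unique p<n refl)))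

    α₁-comm : ∀ x → lookup T x ≡ false → app α₁ (app β x) ≡ app β (app α₁ x)
    α₁-comm x e = begin
        app α₁ (app β x) ≡⟨ cong (λ z → app α₁ (app β z)) (sym (pos-steps x)) ⟩
        app α₁ (pos (suc p)) ≡⟨ app₁-pos (suc p) sp<n ⟩
        iter β (w₁ (suc p)) c ≡⟨ cong (λ z → iter β z c) (step p sp<n (not-start sta) (not-start stb)) ⟩
        app β (iter β (w₁ p) c) ≡⟨ cong (app β) (sym (app₁-pos p (steps-< c x))) ⟩
        app β (app α₁ (pos p)) ≡⟨ cong (λ z → app β (app α₁ z)) (pos-steps x) ⟩
        app β (app α₁ x) ∎
      where
      open ≡-Reasoning
      p = steps c x
      stp : st (suc p) ≡ false
      stp = trans (cong (lookup T) (pos-steps x)) e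
      not-start : ∀ {s} → st s ≡ true → suc p ≢ s
      not-start sts q = true≢false (trans (sym (trans (cong st q) sts)) stp)
      sp<n : suc p < n
      sp<n with m≤n⇒m<n∨m≡n (steps-< c x)
      ... | inj₁ lt = lt
      ... | inj₂ eq = ⊥-elim (true≢false (trans (sym hx₁) (trans (cong (lookup T) (trans (sym pos-n') (trans (cong pos (sym (suc-injective eq))) (pos-steps x)))) e)))

    α₁-sub : disagree β α₁ ⊆ T
    α₁-sub = ⊆-from-lookup (disagree β α₁) T λ x e → in-T x e (lookup T x) refl
      where
      in-T : ∀ x → lookup (disagree β α₁) x ≡ true → (b : Bool) → lookup T x ≡ b → lookup T x ≡ true
      in-T x e true q = q
      in-T x e false q with trans (sym e) (commute⇒∉disagree β α₁ x (α₁-comm x q))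
      ... | ()

    α₁-H : H β α₁ ≢ 0
    α₁-H h = size≢0 (disagree β α₁) xs (¬commute⇒∈disagree β α₁ xs nc) (trans (sym (H≡size β α₁)) h)
      where
      xs = pos (a ∸ 1)
      sa : suc (a ∸ 1) ≡ a
      sa = m+[n∸m]≡n 0<a
      a<n = <-trans a<b b<n
      a∸1<n : a ∸ 1 < n
      a∸1<n = ≤-<-trans (m∸n≤m a 1) a<n
      nc : app α₁ (app β xs) ≢ app β (app α₁ xs)
      nc e = break (iter-uniq (SwapLastBlocks.w< n a b 0<a a<b b<n a a<n) (subst (_< n) (trans (sym sa) (cong suc (sym (wx (a ∸ 1) (subst (a ∸ 1 <_) sa ≤-refl))))) a<n)
        (trans (sym (trans (cong (λ z → app α₁ (iter β z c)) sa) (app₁-pos a a<n)))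
          (trans e (cong (app β) (app₁-pos (a ∸ 1) a∸1<n)))))

    class-lower-bound : n ≤ count (λ α → disagree β α ⊆? T ×-dec ¬? (H β α ≟ 0)) (allPerms n)
    class-lower-bound = orbit-lower-bound α₁ α₁-perm (λ α → disagree β α ⊆? T ×-dec ¬? (H β α ≟ 0))
      λ j → subst (_⊆ T) (sym (disagree-γ α₁ j)) α₁-sub ,
            λ h → α₁-H (trans (H≡size β α₁) (trans (cong size (sym (disagree-γ α₁ j))) (trans (sym (H≡size β (γ α₁ j))) h)))

  class-lower-bound : n ≤ count (λ α → disagree β α ⊆? T ×-dec ¬? (H β α ≟ 0)) (allPerms n)
  class-lower-bound = Witness.class-lower-bound a b 0<a a<b b<n sta stb

module DistanceCount {n'} (β : Tab (suc n')) (hβ : IsNCycle β) where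
  open NCycle β hβ
  open PowerOrbit β hβ

  H≤? : (k : ℕ) → ∀ α → Dec (H β α ≤ k)
  H≤? k α = H β α ≤? k

  H≡0? : ∀ α → Dec (H β α ≡ 0)
  H≡0? α = H β α ≟ 0

  countH≤ : ℕ → ℕ
  countH≤ k = count (H≤? k) (allPerms n)

  noncommuting : ℕ → ℕ
  noncommuting k = count (λ α → H≤? k α ×-dec ¬? (H≡0? α)) (allPerms n)

  countH≤-split : ∀ k → countH≤ k ≡ n + noncommuting k
  countH≤-split k = trans (count-split (H≤? k) H≡0? (allPerms n))
    (cong (_+ noncommuting k) (trans (count-cong (λ α → H≤? k α ×-dec H≡0? α) H≡0? (allPerms n) (λ _ _ → proj₂)
       (λ α _ h → subst (_≤ k) (sym h) z≤n , h)) centralizer-size))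

  class : Vec Bool n → ℕ
  class T = count (λ α → disagree β α ⊆? T ×-dec ¬? (H≡0? α)) (allPerms n)

  -- The class of T contains the n commuting α, so at most n·k'! - n others.
  class-bound : ∀ k' T → size T ≡ suc k' → class T ≤ n * k' ! ∸ n
  class-bound k' T hT = subst (_≤ n * k' ! ∸ n) (m+n∸m≡n n (class T))
    (∸-monoˡ-≤ n (subst (_≤ n * k' !) whole-class (ClassEncoding.class-upper-bound β hβ k' T hT x₁ hx₁)))
    where
    x₁ = proj₁ (find-member T hT)
    hx₁ = proj₂ (find-member T hT)
    H≡0⇒⊆ : ∀ α → H β α ≡ 0 → disagree β α ⊆ T
    H≡0⇒⊆ α h = ⊆-from-lookup (disagree β α) T (λ i q → ⊥-elim (true≢false
      (trans (sym q) (size≡0-lookup (disagree β α) (trans (sym (H≡size β α)) h) i))))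
    whole-class : count (λ α → disagree β α ⊆? T) (allPerms n) ≡ n + class T
    whole-class = trans (count-split (λ α → disagree β α ⊆? T) H≡0? (allPerms n))
      (cong (_+ class T) (trans (count-cong (λ α → disagree β α ⊆? T ×-dec H≡0? α) H≡0? (allPerms n) (λ _ _ → proj₂)
        (λ α _ h → H≡0⇒⊆ α h , h)) centralizer-size))

  noncommuting-bound : ∀ k' → suc k' ≤ n → noncommuting (suc k') ≤ (n C suc k') * (n * k' ! ∸ n)
  noncommuting-bound k' k≤n = ≤-trans
    (union-bound (λ α → H≤? (suc k') α ×-dec ¬? (H≡0? α)) (λ T α → disagree β α ⊆? T ×-dec ¬? (H≡0? α))
      (allPerms n) (kSubsets n (suc k')) covered)
    (subst (sum (map class (kSubsets n (suc k'))) ≤_) (cong (_* (n * k' ! ∸ n)) (length-kSubsets n (suc k')))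
      (sum-map-≤ class (n * k' ! ∸ n) (kSubsets n (suc k')) (λ T m → class-bound k' T (kSubsets-size n (suc k') m))))
    where
    covered : ∀ α → α ∈ allPerms n → H β α ≤ suc k' × H β α ≢ 0 →
      ∃ λ T → T ∈ kSubsets n (suc k') × (disagree β α ⊆ T × H β α ≢ 0)
    covered α _ (h , h0) =
      let (T , mT , sT) = kSubset-cover n (suc k') (disagree β α) (subst (_≤ suc k') (H≡size β α) h) k≤n
      in T , mT , sT , h0

  rhs : ℕ → ℕ
  rhs k = n * (n C k) * fact-pred k ∸ n * (n C k) + n

  rhs-as-sum : ∀ Cc f → n + Cc * (n * f ∸ n) ≡ n * Cc * f ∸ n * Cc + n
  rhs-as-sum Cc f = trans (+-comm n _) (cong (_+ n) (trans (*-distribˡ-∸ Cc (n * f) n)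
    (cong₂ _∸_ (trans (sym (*-assoc Cc n f)) (cong (_* f) (*-comm Cc n))) (*-comm Cc n))))

  -- For k ≤ 2, (k-1)! = 1: no noncommuting α has H ≤ k, and rhs k = n.
  noncommuting-≤2 : ∀ k → k ≤ 2 → k ≤ n → noncommuting k ≡ 0
  noncommuting-≤2 zero _ _ = count-none (λ α → H≤? 0 α ×-dec ¬? (H≡0? α)) (allPerms n) (λ α _ (a , b) → b (n≤0⇒n≡0 a))
  noncommuting-≤2 (suc k') (s≤s k'≤1) k≤n = n≤0⇒n≡0 (subst (noncommuting (suc k') ≤_) no-room (noncommuting-bound k' k≤n))
    where
    no-room : (n C suc k') * (n * k' ! ∸ n) ≡ 0
    no-room = trans (cong (λ z → (n C suc k') * (n * z ∸ n)) (k'!≡1 k' k'≤1))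
      (trans (cong (λ z → (n C suc k') * (z ∸ n)) (*-identityʳ n)) (trans (cong ((n C suc k') *_) (n∸n≡0 n)) (*-zeroʳ (n C suc k'))))
      where k'!≡1 : ∀ k' → k' ≤ 1 → k' ! ≡ 1
            k'!≡1 zero _ = refl
            k'!≡1 (suc zero) _ = refl
            k'!≡1 (suc (suc _)) (s≤s ())

  rhs-≤2 : ∀ k → k ≤ 2 → rhs k ≡ n
  rhs-≤2 k k≤2 = cong (_+ n) (trans (cong (λ z → n * (n C k) * z ∸ n * (n C k)) (fact-pred≡1 k k≤2))
    (trans (cong (_∸ n * (n C k)) (*-identityʳ (n * (n C k)))) (n∸n≡0 (n * (n C k)))))
    where
    fact-pred≡1 : ∀ k → k ≤ 2 → fact-pred k ≡ 1
    fact-pred≡1 zero _ = refl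
    fact-pred≡1 (suc zero) _ = refl
    fact-pred≡1 (suc (suc zero)) _ = refl
    fact-pred≡1 (suc (suc (suc _))) (s≤s (s≤s ()))

  exact-≤2 : ∀ k → k ≤ 2 → k ≤ n → countH≤ k ≡ rhs k
  exact-≤2 k k≤2 k≤n = begin
    countH≤ k             ≡⟨ countH≤-split k ⟩
    n + noncommuting k    ≡⟨ cong (n +_) (noncommuting-≤2 k k≤2 k≤n) ⟩
    n + 0                 ≡⟨ +-identityʳ n ⟩
    n                     ≡⟨ sym (rhs-≤2 k k≤2) ⟩
    rhs k                 ∎
    where open ≡-Reasoning

  upper-bound : ∀ k → k ≤ n → countH≤ k ≤ rhs k
  upper-bound zero _ = ≤-reflexive (exact-≤2 0 z≤n z≤n)
  upper-bound (suc k') k≤n = subst₂ _≤_ (sym (countH≤-split (suc k'))) (rhs-as-sum (n C suc k') (k' !))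
    (+-monoʳ-≤ n (noncommuting-bound k' k≤n))

  -- For k = n every α counts: c(≤ n, β) = n! = rhs n.
  exact-n : countH≤ n ≡ rhs n
  exact-n = trans (count-all (H≤? n) (allPerms n) (λ α → subst (_≤ n) (sym (H≡size β α)) (size≤n (disagree β α))))
    (trans (length-allPerms n) (sym rhs-n))
    where
    rhs-n : rhs n ≡ n !
    rhs-n = begin
      n * (n C n) * fact-pred n ∸ n * (n C n) + n ≡⟨ cong (λ z → n * z * fact-pred n ∸ n * z + n) (nCn≡1 n) ⟩
      n * 1 * n' ! ∸ n * 1 + n                    ≡⟨ cong (λ z → z * n' ! ∸ z + n) (*-identityʳ n) ⟩
      n ! ∸ n + n                                 ≡⟨ m∸n+n≡m (subst (_≤ n !) (*-identityʳ n) (*-monoʳ-≤ n (1≤n! n'))) ⟩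
      n !                                         ∎
      where open ≡-Reasoning

  -- For k = 3 the class bound n·2 - n = n is attained by every 3-subset.
  class-of-three : ∀ T → T ∈ kSubsets n 3 → class T ≡ n
  class-of-three T m = ≤-antisym (subst (class T ≤_) n*2∸n≡n (class-bound 2 T hT))
    (ClassOfThree.class-lower-bound β hβ T hT (proj₁ (find-member T hT)) (proj₂ (find-member T hT)))
    where
    hT = kSubsets-size n 3 m
    n*2∸n≡n : n * 2 ∸ n ≡ n
    n*2∸n≡n = trans (cong (_∸ n) (trans (*-comm n 2) (cong (n +_) (+-identityʳ n)))) (m+n∸m≡n n n)

  -- Each α with H = 3 lies in exactly one class, namely that of its
  -- disagreement set; α with 0 < H ≤ 2 do not exist, and larger H are in none.
  in-one-class : 3 ≤ n → ∀ α → α ∈ allPerms n →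
    count (λ T → disagree β α ⊆? T ×-dec ¬? (H≡0? α)) (kSubsets n 3) ≡ ind (H≤? 3 α ×-dec ¬? (H≡0? α))
  in-one-class 3≤n α mα = by-size (H β α) refl
    where
    Q? = λ T → disagree β α ⊆? T ×-dec ¬? (H≡0? α)
    noncommuting-2 : noncommuting 2 ≡ 0
    noncommuting-2 = noncommuting-≤2 2 ≤-refl (≤-trans (n≤1+n 2) 3≤n)
    by-size : ∀ h → H β α ≡ h → count Q? (kSubsets n 3) ≡ ind (H≤? 3 α ×-dec ¬? (H≡0? α))
    by-size zero h0 = trans (count-none Q? (kSubsets n 3) (λ T _ (_ , b) → b h0))
      (sym (ind-no (H≤? 3 α ×-dec ¬? (H≡0? α)) (λ (_ , b) → b h0)))
    by-size (suc zero) h1 = ⊥-elim (count≡0 (λ α → H≤? 2 α ×-dec ¬? (H≡0? α)) noncommuting-2 mα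
      (subst (_≤ 2) (sym h1) (s≤s z≤n) , λ e → 1+n≢0 (trans (sym h1) e)))
    by-size (suc (suc zero)) h2 = ⊥-elim (count≡0 (λ α → H≤? 2 α ×-dec ¬? (H≡0? α)) noncommuting-2 mα
      (≤-reflexive h2 , λ e → 1+n≢0 (trans (sym h2) e)))
    by-size (suc (suc (suc zero))) h3 = trans
      (count-cong Q? (λ T → disagree β α ⊆? T) (kSubsets n 3) (λ _ _ → proj₁) (λ _ _ s → s , h0))
      (trans (count-kSubsets-⊇-exact n 3 (disagree β α) (trans (sym (H≡size β α)) h3))
             (sym (ind-yes (H≤? 3 α ×-dec ¬? (H≡0? α)) (≤-reflexive h3 , h0))))
      where h0 : H β α ≢ 0
            h0 e = 1+n≢0 (trans (sym h3) e)
    by-size (suc (suc (suc (suc h)))) h4 = trans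
      (n≤0⇒n≡0 (subst (count Q? (kSubsets n 3) ≤_) (count-kSubsets-⊇-large n 3 (disagree β α) (subst (3 <_) (H≡size β α) 3<H))
        (count-mono Q? (λ T → disagree β α ⊆? T) (kSubsets n 3) (λ _ _ → proj₁))))
      (sym (ind-no (H≤? 3 α ×-dec ¬? (H≡0? α)) (λ (a , _) → <⇒≱ 3<H a)))
      where 3<H : 3 < H β α
            3<H = subst (3 <_) (sym h4) (s≤s (s≤s (s≤s (s≤s z≤n))))

  noncommuting-3 : 3 ≤ n → noncommuting 3 ≡ (n C 3) * n
  noncommuting-3 3≤n = begin
    noncommuting 3
      ≡⟨ exact-cover (λ α → H≤? 3 α ×-dec ¬? (H≡0? α)) (λ T α → disagree β α ⊆? T ×-dec ¬? (H≡0? α))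
           (allPerms n) (kSubsets n 3) (in-one-class 3≤n) ⟩
    sum (map class (kSubsets n 3))       ≡⟨ sum-map-cong class (λ _ → n) (kSubsets n 3) class-of-three ⟩
    sum (map (λ _ → n) (kSubsets n 3))   ≡⟨ sum-map-const n (kSubsets n 3) ⟩
    length (kSubsets n 3) * n            ≡⟨ cong (_* n) (length-kSubsets n 3) ⟩
    (n C 3) * n                          ∎
    where open ≡-Reasoning

  exact-3 : 3 ≤ n → countH≤ 3 ≡ rhs 3
  exact-3 3≤n = trans (countH≤-split 3) (trans (cong (n +_) (noncommuting-3 3≤n)) (trans (+-comm n _) (cong (_+ n) (sym rhs-3))))
    where
    Cc = n C 3
    rhs-3 : n * Cc * 2 ∸ n * Cc ≡ Cc * n
    rhs-3 = trans (cong (_∸ n * Cc) (trans (*-comm (n * Cc) 2) (cong (n * Cc +_) (+-identityʳ (n * Cc)))))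
              (trans (m+n∸m≡n (n * Cc) (n * Cc)) (*-comm n Cc))

  exact-≤3 : ∀ k → k ≤ 3 → k ≤ n → countH≤ k ≡ rhs k
  exact-≤3 k k≤3 k≤n with m≤n⇒m<n∨m≡n k≤3
  ... | inj₁ k<3 = exact-≤2 k (s≤s⁻¹ k<3) k≤n
  ... | inj₂ refl = exact-3 k≤n

theorem3p8 : (n : ℕ) (β : Tab n) → IsNCycle β → (k : ℕ) → k ≤ n →
    (c≤ k β ≤ n * (n C k) * fact-pred k ∸ n * (n C k) + n)
    × ((k ≤ 3 ⊎ k ≡ n) → c≤ k β ≡ n * (n C k) * fact-pred k ∸ n * (n C k) + n)
theorem3p8 zero β (_ , (() , _)) k k≤n
theorem3p8 (suc n') β hβ k k≤n = upper-bound k k≤n , equality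
  where
  open DistanceCount β hβ
  equality : (k ≤ 3 ⊎ k ≡ suc n') → countH≤ k ≡ rhs k
  equality (inj₁ k≤3) = exact-≤3 k k≤3 k≤n
  equality (inj₂ refl) = exact-n
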